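{- Let $n\ge3$, $k\ge0$, let $R$ be a maximal reversible set in $G_n^k$ which is not a canonical reversible set, and let $x_1,\dots,x_{k+1}$ be a consistent labeling of $A(R)$. Let $i$ be the least positive integer with $|B(x_i,R)|\ne k+2-i$. Then: (1) $2\le i\le k-n+2$; (2) $|B(x_i,R)|=k+4-i-n$; (3) for every $j\in\{i+1,\dots,k+1\}$, $|B(x_j,R)|\le k+3-i-n$.
   Context: The crown $S_n^k$ is the height-2 poset on $A\cup B$, $A=\{a_1,\dots,a_{n+k}\}$ minimal, $B=\{b_1,\dots,b_{n+k}\}$ maximal, indices cyclic mod $n+k$; $a_i$ is incomparable to $b_j$ iff $j\in\{i,\dots,i+k\}$ (mod $n+k$), otherwise $a_i<b_j$. $\mathrm{Inc}(A,B)$: incomparable pairs $(a,b)\in A\times B$; $G_n^k$: graph on $\mathrm{Inc}(A,B)$ with $(a,b)\sim(x,y)$ iff $a<y$ and $x<b$. $R\subseteq\mathrm{Inc}(A,B)$ is reversible if some linear extension $L$ of $S_n^k$ has $x>y$ in $L$ for all $(x,y)\in R$; maximal reversible = reversible and not properly contained in a reversible set (such $R$ has $|A(R)|=k+1$). $A(R)=\{a:(a,b)\in R\text{ for some }b\}$, $B(a,R)=\{b:(a,b)\in R\}$. A labeling $x_1,\dots,x_{k+1}$ of $A(R)$ is consistent if $B(x_\beta,R)\subseteq B(x_\alpha,R)$ whenever $\alpha<\beta$. A subset of $A$ is contiguous if it is a block of cyclically consecutive elements; a sequence $\sigma=(x_1,\dots,x_r)$ of distinct elements of $A$ is $h$-contiguous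 if each $\{x_1,\dots,x_i\}$ is contiguous. $T(\sigma)$ contains all $(x_1,b)\in\mathrm{Inc}(A,B)$ and, for $1\le i<r$, $(x_{i+1},b)$ iff $(x_{i+1},b)\in\mathrm{Inc}(A,B)$ and $(x_i,b)\in T(\sigma)$. A canonical reversible set is $T(\sigma)$ for an $h$-contiguous $\sigma$ of length $k+1$. -}

module Defs where

open import Data.Nat using (ℕ; zero; suc; _+_; _≤_; _<_)
open import Data.Fin using (Fin; zero; suc; toℕ; inject₁)
open import Data.Fin.Subset using (Subset; _∈_; _⊆_; Nonempty)
open import Data.Product using (Σ; ∃; ∃-syntax; _×_; _,_)
open import Data.Sum using (_⊎_; inj₁; inj₂)
open import Function using (_∘_)
open import Function.Definitions using (Injective)
open import Relation.Binary.PropositionalEquality using (_≡_)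
open import Relation.Nullary using (¬_)

-- Crown S_n^k with N = n + k.  a_i is represented by (i : Fin (n + k)) on the A side,
-- b_j by (j : Fin (n + k)) on the B side (indices 0-based, cyclic mod N).

-- j ≡ i + t (mod N) for some 0 ≤ t ≤ k.  Since i, j < N and t ≤ k < N,
-- "i + t ≡ j mod N" is exactly "i + t = j or i + t = j + N".
Inc : (n k : ℕ) → Fin (n + k) → Fin (n + k) → Set
Inc n k i j = ∃[ t ] (t ≤ k × (toℕ i + t ≡ toℕ j ⊎ toℕ i + t ≡ toℕ j + (n + k)))

-- Elements of the crown: inj₁ a = element of A, inj₂ b = element of B.
Elt : ℕ → Set
Elt N = Fin N ⊎ Fin N

-- A linear extension of S_n^k: a linear order on A ∪ B, given as an injective
-- ranking into ℕ, such that a_i is below b_j whenever a_i < b_j in S_n^k,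
-- i.e. whenever (a_i, b_j) is not incomparable.  (A and B are antichains.)
record LinearExtension (n k : ℕ) : Set where
  field
    pos       : Elt (n + k) → ℕ
    pos-inj   : Injective _≡_ _≡_ pos
    pos-order : ∀ a b → ¬ Inc n k a b → pos (inj₁ a) < pos (inj₂ b)
open LinearExtension public

-- A set R ⊆ A × B, given rowwise: R a = B(a, R).
RSet : ℕ → ℕ → Set
RSet n k = Fin (n + k) → Subset (n + k)

InInc : (n k : ℕ) → RSet n k → Set
InInc n k R = ∀ a b → b ∈ R a → Inc n k a b

SubR : (n k : ℕ) → RSet n k → RSet n k → Set
SubR n k R R' = ∀ a → R a ⊆ R' a

Reversible : (n k : ℕ) → RSet n k → Set
Reversible n k R =
  InInc n k R × Σ (LinearExtension n k) (λ L → ∀ a b → b ∈ R a → pos L (inj₂ b) < pos L (inj₁ a))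

MaxReversible : (n k : ℕ) → RSet n k → Set
MaxReversible n k R = Reversible n k R × (∀ R' → Reversible n k R' → SubR n k R R' → SubR n k R' R)

InA : (n k : ℕ) → RSet n k → Fin (n + k) → Set
InA n k R a = Nonempty (R a)

-- consistent labeling x_1..x_{k+1} (0-based: x 0 .. x k) of A(R)
ConsistentLabeling : (n k : ℕ) → RSet n k → (Fin (suc k) → Fin (n + k)) → Set
ConsistentLabeling n k R x =
  Injective _≡_ _≡_ x
  × (∀ a → (InA n k R a → ∃[ m ] x m ≡ a) × (∃[ m ] x m ≡ a → InA n k R a))
  × (∀ α β → toℕ α < toℕ β → R (x β) ⊆ R (x α))

InBlock : (N : ℕ) → Fin N → ℕ → Fin N → Set
InBlock N s l a = ∃[ t ] (t < l × (toℕ s + t ≡ toℕ a ⊎ toℕ s + t ≡ toℕ a + N))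

Contiguous : (N : ℕ) → (Fin N → Set) → Set
Contiguous N S = ∃[ s ] ∃[ l ] (l ≤ N × (∀ a → (S a → InBlock N s l a) × (InBlock N s l a → S a)))

Prefix : ∀ {N r} → (Fin r → Fin N) → ℕ → Fin N → Set
Prefix σ i a = ∃[ m ] (toℕ m < i × σ m ≡ a)

HContiguous : ∀ {N r} → (Fin r → Fin N) → Set
HContiguous {N} {r} σ = ∀ i → 1 ≤ i → i ≤ r → Contiguous N (Prefix σ i)

Tmem : (n k : ℕ) → ∀ {r} → (Fin (suc r) → Fin (n + k)) → Fin (suc r) → Fin (n + k) → Set
Tmem n k σ zero b = Inc n k (σ zero) b
Tmem n k {suc r} σ (suc m) b = Inc n k (σ (suc m)) b × Tmem n k (σ ∘ inject₁) m b

InT : (n k : ℕ) → ∀ {r} → (Fin (suc r) → Fin (n + k)) → Fin (n + k) → Fin (n + k) → Set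
InT n k σ a b = ∃[ m ] (σ m ≡ a × Tmem n k σ m b)

Canonical : (n k : ℕ) → RSet n k → Set
Canonical n k R =
  Σ (Fin (suc k) → Fin (n + k)) λ σ →
    Injective _≡_ _≡_ σ × HContiguous σ
    × (∀ a b → (b ∈ R a → InT n k σ a b) × (InT n k σ a b → b ∈ R a))

module Submission where

open import Defs
open import Data.Nat using (ℕ; zero; suc; pred; _+_; _*_; _∸_; _≤_; _<_; _≤?_; _<?_; z≤n; s≤s; NonZero; >-nonZero)
open import Data.Nat.Properties
open import Data.Nat.DivMod using (_%_; _/_; [m+kn]%n≡m%n; m<n⇒m%n≡m; +-distrib-/; m*n%n≡0; m*n/n≡m; m<n⇒m/n≡0)
open import Data.Nat.Tactic.RingSolver using (solve)
open import Data.Fin using (Fin; zero; suc; toℕ; fromℕ; fromℕ<)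
open import Data.Fin.Properties using (toℕ<n; toℕ-injective; toℕ-fromℕ; toℕ-fromℕ<; all?) renaming (_≟_ to _≟ᶠ_)
open import Data.Fin.Subset using (Subset; _∈_; _⊆_; ∣_∣; ⁅_⁆; inside; outside) renaming (⊥ to ∅; ⊤ to ⊤ₛ)
open import Data.Fin.Subset.Properties
  using (p⊆q⇒∣p∣≤∣q∣; p⊂q⇒∣p∣<∣q∣; ∣⊥∣≡0; ⊆-min; ∣⁅x⁆∣≡1; x∈⁅x⁆; x∈⁅y⁆⇒x≡y; ∈⊤; ∣⊤∣≡n)
open import Data.List as List using (List; []; _∷_; filter; allFin)
open import Data.List.Extrema.Nat using (argmax; argmax-all; f[xs]≤f[argmax]; max; v≤max⁺; max≤v⁺)
open import Data.List.Membership.Propositional.Properties using (∈-map⁺; ∈-filter⁺; ∈-allFin)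
open import Data.List.Relation.Unary.All as All using ()
open import Data.List.Relation.Unary.All.Properties using (all-filter; map⁺)
open import Data.List.Relation.Unary.Any as Any using ()
open import Data.Vec as Vec using (tabulate; here; there)
open import Data.Vec.Properties using (lookup∘tabulate; lookup⇒[]=; []=⇒lookup)
open import Data.Product using (∃-syntax; _×_; _,_; proj₁; proj₂)
open import Data.Sum using (_⊎_; inj₁; inj₂)
open import Data.Sum.Properties using (inj₁-injective)
open import Data.Empty using (⊥; ⊥-elim)
open import Data.Unit using (tt)
open import Function using (_∘_)
open import Function.Definitions using (Injective)
open import Level using (0ℓ)
open import Relation.Nullary using (¬_; Dec; yes; no; does)
open import Relation.Nullary.Decidable using (dec-true; ¬?; _→-dec_)
open import Relation.Unary using (Pred; Decidable; U)
open import Relation.Unary.Properties using (U?)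
open import Relation.Binary.PropositionalEquality
open import Relation.Binary.Definitions using (tri<; tri≈; tri>)

-- Fix a linear extension L witnessing that R is reversible and let P a be the position of a ∈ A in L.
-- Maximality determines R from L: b ∈ B(a, R) iff every a' < b lies below a in L, so B(a, R) grows
-- with P a and the consistent labelling lists A(R) from the top of L downwards.  Measure everything
-- on the cycle from a point s lying in every B(x_α, R).  Inductively x_0, …, x_j are the top j + 1
-- elements of L and occupy an interval of j + 1 consecutive positions.  Let m be the next element of L.
-- If m is adjacent to the interval, the interval grows, m = x_{j+1} and |B| drops by exactly one.  If
-- m is at distance between 2 and n - 1, promoting the element next to the interval just above m in L
-- would give a strictly larger reversible set; so m is at distance at least n.  Then B(m, R) is
-- B(x_j, R) minus the n - 1 elements above m, m = x_{j+1}, every later label has a smaller B, and the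
-- interval and m fit inside [0, k] only if j + n ≤ k.  Hence the first label leaving the staircase
-- |B(x_i, R)| = k + 2 - i drops by n - 1 instead of 1, which gives all three claims.

module _ {m : ℕ} where

  subset : {P : Pred (Fin m) 0ℓ} → Decidable P → Subset m
  subset P? = tabulate (does ∘ P?)

  module _ {P : Pred (Fin m) 0ℓ} (P? : Decidable P) where

    ∈-subset⁺ : ∀ {x} → P x → x ∈ subset P?
    ∈-subset⁺ {x} px = lookup⇒[]= x _ (trans (lookup∘tabulate _ x) (dec-true (P? x) px))

    ∈-subset⁻ : ∀ {x} → x ∈ subset P? → P x
    ∈-subset⁻ {x} x∈ with P? x | trans (sym (lookup∘tabulate (does ∘ P?) x)) ([]=⇒lookup x∈)
    ... | yes px | _ = px
    ... | no  _  | ()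

  ⊆-antisym⇒∣∣≡ : {p q : Subset m} → p ⊆ q → q ⊆ p → ∣ p ∣ ≡ ∣ q ∣
  ⊆-antisym⇒∣∣≡ p⊆q q⊆p = ≤-antisym (p⊆q⇒∣p∣≤∣q∣ p⊆q) (p⊆q⇒∣p∣≤∣q∣ q⊆p)

  module _ {S : Pred (Fin m) 0ℓ} (S? : Decidable S) (f : Fin m → ℕ) where

    opaque
      ∃-maximiser : ∀ {a₀} → S a₀ → ∃[ c ] S c × (∀ a → S a → f a ≤ f c)
      ∃-maximiser {a₀} sa₀ =
        argmax f a₀ xs , argmax-all f sa₀ (all-filter S? (allFin m)) ,
        λ a sa → All.lookup (f[xs]≤f[argmax] a₀ xs) (∈-filter⁺ S? (∈-allFin a) sa)
        where
        xs : List (Fin m)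
        xs = filter S? (allFin m)

module _ where

  open Vec using ([]; _∷_)

  ∣∣-partition : ∀ {m} (p q r : Subset m) → (∀ {x} → x ∈ p → x ∈ q ⊎ x ∈ r) → q ⊆ p → r ⊆ p →
                 (∀ {x} → x ∈ q → ¬ x ∈ r) → ∣ p ∣ ≡ ∣ q ∣ + ∣ r ∣
  ∣∣-partition [] [] [] _ _ _ _ = refl
  ∣∣-partition (u ∷ p) (v ∷ q) (w ∷ r) cover q⊆p r⊆p disj =
    heads u v w cover q⊆p r⊆p disj
      (∣∣-partition p q r (tails ∘ cover ∘ there) (tail ∘ q⊆p ∘ there) (tail ∘ r⊆p ∘ there)
                          (λ x∈q x∈r → disj (there x∈q) (there x∈r)))
    where
    tail : ∀ {s : Subset _} {b x} → suc x ∈ b ∷ s → x ∈ s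
    tail (there x∈s) = x∈s
    tails : ∀ {s t : Subset _} {b c x} → suc x ∈ b ∷ s ⊎ suc x ∈ c ∷ t → x ∈ s ⊎ x ∈ t
    tails (inj₁ (there x∈s)) = inj₁ x∈s
    tails (inj₂ (there x∈t)) = inj₂ x∈t
    heads : ∀ u v w → (zero ∈ u ∷ p → zero ∈ v ∷ q ⊎ zero ∈ w ∷ r) → (zero ∈ v ∷ q → zero ∈ u ∷ p) →
            (zero ∈ w ∷ r → zero ∈ u ∷ p) → (zero ∈ v ∷ q → ¬ zero ∈ w ∷ r) →
            ∣ p ∣ ≡ ∣ q ∣ + ∣ r ∣ → ∣ u ∷ p ∣ ≡ ∣ v ∷ q ∣ + ∣ w ∷ r ∣
    heads inside  inside  inside  _ _ _ d _  = ⊥-elim (d here here)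
    heads inside  inside  outside _ _ _ _ ih = cong suc ih
    heads inside  outside inside  _ _ _ _ ih = trans (cong suc ih) (sym (+-suc _ _))
    heads inside  outside outside c _ _ _ _  with c here
    ... | inj₁ ()
    ... | inj₂ ()
    heads outside inside  _       _ v _ _ _  with v here
    ... | ()
    heads outside outside inside  _ _ w _ _  with w here
    ... | ()
    heads outside outside outside _ _ _ _ ih = ih

remainder-quotient-injective : ∀ d .{{_ : NonZero d}} {r r' q q'} → r < d → r' < d →
                               r + q * d ≡ r' + q' * d → r ≡ r' × q ≡ q'
remainder-quotient-injective d {r} {r'} {q} {q'} r<d r'<d eq =
  trans (sym (remainder q r<d)) (trans (cong (_% d) eq) (remainder q' r'<d)) ,
  trans (sym (quotient q r<d)) (trans (cong (_/ d) eq) (quotient q' r'<d))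
  where
  open ≡-Reasoning
  remainder : ∀ {s} p → s < d → (s + p * d) % d ≡ s
  remainder {s} p s<d = trans ([m+kn]%n≡m%n s p d) (m<n⇒m%n≡m s<d)
  quotient : ∀ {s} p → s < d → (s + p * d) / d ≡ p
  quotient {s} p s<d = begin
    (s + p * d) / d       ≡⟨ +-distrib-/ s (p * d) remainders<d ⟩
    s / d + p * d / d     ≡⟨ cong₂ _+_ (m<n⇒m/n≡0 s<d) (m*n/n≡m p d) ⟩
    p                     ∎
    where
    remainders<d : s % d + p * d % d < d
    remainders<d = subst (_< d) (sym (cong₂ _+_ (m<n⇒m%n≡m s<d) (m*n%n≡0 p d)))
                                (subst (_< d) (sym (+-identityʳ s)) s<d)

≢⇒<⊎> : ∀ {m n} → m ≢ n → m < n ⊎ n < m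
≢⇒<⊎> {m} {n} m≢n with <-cmp m n
... | tri< m<n _ _ = inj₁ m<n
... | tri≈ _ m≡n _ = ⊥-elim (m≢n m≡n)
... | tri> _ _ n<m = inj₂ n<m

+≡⇒≤ : ∀ {a b} d → a + d ≡ b → a ≤ b
+≡⇒≤ {a} d refl = m≤m+n a d

≤-by-shift : ∀ {a b A B} X e d → a ≤ b → A + e ≡ a + X → b + X + d ≡ B → A ≤ B
≤-by-shift {a} {b} {A} X e d a≤b eq₁ eq₂ =
  ≤-trans (m≤m+n A e) (≤-trans (≤-reflexive eq₁) (≤-trans (+-monoˡ-≤ X a≤b) (≤-trans (m≤m+n (b + X) d) (≤-reflexive eq₂))))

<-scaled : ∀ {u v} r r' → r ≤ 1 → u < v → r + u * 2 < r' + v * 2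
<-scaled {u} {v} r r' r≤1 u<v = begin-strict
  r + u * 2   <⟨ +-monoˡ-< (u * 2) (s≤s r≤1) ⟩
  2 + u * 2   ≤⟨ *-monoˡ-≤ 2 u<v ⟩
  v * 2       ≤⟨ m≤n+m (v * 2) r' ⟩
  r' + v * 2  ∎
  where open ≤-Reasoning

module CyclicDistance (N : ℕ) where

  Wraps : ℕ → ℕ → Set
  Wraps x y = x ≡ y ⊎ x ≡ y + N

  private
    +-cancel-shift : ∀ a u v m → a + v ≡ (a + u) + m → v ≡ u + m
    +-cancel-shift a u v m e = +-cancelˡ-≡ a v (u + m) (trans e (+-assoc a u m))

    <N⇒≢+N : ∀ {v u} → v < N → v ≢ u + N
    <N⇒≢+N {v} {u} v<N e = <-irrefl refl (≤-trans v<N (subst (N ≤_) (sym e) (m≤n+m N u)))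

  wraps-unique : ∀ {x y t t'} → t < N → t' < N → Wraps (x + t) y → Wraps (x + t') y → t ≡ t'
  wraps-unique {x} {_} {t} {t'} _   _    (inj₁ e) (inj₁ e') = +-cancelˡ-≡ x t t' (trans e (sym e'))
  wraps-unique {x} {_} {t} {t'} _   t'<N (inj₁ e) (inj₂ e') =
    ⊥-elim (<N⇒≢+N t'<N (+-cancel-shift x t t' N (trans e' (cong (_+ N) (sym e)))))
  wraps-unique {x} {_} {t} {t'} t<N _    (inj₂ e) (inj₁ e') =
    ⊥-elim (<N⇒≢+N t<N (+-cancel-shift x t' t N (trans e (cong (_+ N) (sym e')))))
  wraps-unique {x} {_} {t} {t'} _   _    (inj₂ e) (inj₂ e') = +-cancelˡ-≡ x t t' (trans e (sym e'))

  opaque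
    dist : Fin N → Fin N → ℕ
    dist a b with toℕ a ≤? toℕ b
    ... | yes _ = toℕ b ∸ toℕ a
    ... | no  _ = (toℕ b + N) ∸ toℕ a

    dist-wraps : ∀ a b → Wraps (toℕ a + dist a b) (toℕ b)
    dist-wraps a b with toℕ a ≤? toℕ b
    ... | yes a≤b = inj₁ (m+[n∸m]≡n a≤b)
    ... | no  _   = inj₂ (m+[n∸m]≡n (≤-trans (<⇒≤ (toℕ<n a)) (m≤n+m N (toℕ b))))

    dist<N : ∀ a b → dist a b < N
    dist<N a b with toℕ a ≤? toℕ b
    ... | yes _   = ≤-<-trans (m∸n≤m (toℕ b) (toℕ a)) (toℕ<n b)
    ... | no  a≰b = +-cancelˡ-< (toℕ a) _ _
                      (subst (_< toℕ a + N) (sym (m+[n∸m]≡n (≤-trans (<⇒≤ (toℕ<n a)) (m≤n+m N (toℕ b)))))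
                             (+-monoˡ-< N (≰⇒> a≰b)))

  dist-unique : ∀ a b {t} → t < N → Wraps (toℕ a + t) (toℕ b) → dist a b ≡ t
  dist-unique a b t<N w = wraps-unique (dist<N a b) t<N (dist-wraps a b) w

  dist-injectiveʳ : ∀ a {b b'} → dist a b ≡ dist a b' → b ≡ b'
  dist-injectiveʳ a {b} {b'} e =
    toℕ-injective (same-target (dist-wraps a b) (subst (λ d → Wraps (toℕ a + d) (toℕ b')) (sym e) (dist-wraps a b')))
    where
    same-target : ∀ {z} → Wraps z (toℕ b) → Wraps z (toℕ b') → toℕ b ≡ toℕ b'
    same-target (inj₁ p) (inj₁ q) = trans (sym p) q
    same-target (inj₁ p) (inj₂ q) = ⊥-elim (<N⇒≢+N (toℕ<n b) (trans (sym p) q))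
    same-target (inj₂ p) (inj₁ q) = ⊥-elim (<N⇒≢+N (toℕ<n b') (trans (sym q) p))
    same-target (inj₂ p) (inj₂ q) = +-cancelʳ-≡ N (toℕ b) (toℕ b') (trans (sym p) q)

  dist-injectiveˡ : ∀ {a a'} b → dist a b ≡ dist a' b → a ≡ a'
  dist-injectiveˡ {a} {a'} b e = toℕ-injective (wraps-unique (toℕ<n a) (toℕ<n a') (commute a refl) (commute a' (sym e)))
    where
    commute : ∀ a″ → dist a″ b ≡ dist a b → Wraps (dist a b + toℕ a″) (toℕ b)
    commute a″ e″ = subst (λ z → Wraps z (toℕ b)) (trans (cong (toℕ a″ +_) e″) (+-comm (toℕ a″) (dist a b)))
                          (dist-wraps a″ b)

  dist-surjectiveʳ : ∀ a {t} → t < N → ∃[ b ] dist a b ≡ t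
  dist-surjectiveʳ a {t} t<N with toℕ a + t <? N
  ... | yes a+t<N = fromℕ< a+t<N , dist-unique a _ t<N (inj₁ (sym (toℕ-fromℕ< a+t<N)))
  ... | no  a+t≮N = fromℕ< r<N , dist-unique a _ t<N (inj₂ (sym (trans (cong (_+ N) (toℕ-fromℕ< r<N)) (m∸n+n≡m N≤a+t))))
    where
    N≤a+t : N ≤ toℕ a + t
    N≤a+t = ≮⇒≥ a+t≮N
    r<N : toℕ a + t ∸ N < N
    r<N = +-cancelʳ-< N _ N (subst (_< N + N) (sym (m∸n+n≡m N≤a+t)) (+-mono-< (toℕ<n a) t<N))

  dist-surjectiveˡ : ∀ b {t} → t < N → ∃[ a ] dist a b ≡ t
  dist-surjectiveˡ b {t} t<N with t ≤? toℕ b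
  ... | yes t≤b = fromℕ< r<N , dist-unique _ b t<N (inj₁ (trans (cong (_+ t) (toℕ-fromℕ< r<N)) (m∸n+n≡m t≤b)))
    where
    r<N : toℕ b ∸ t < N
    r<N = ≤-<-trans (m∸n≤m (toℕ b) t) (toℕ<n b)
  ... | no  t≰b = fromℕ< r<N , dist-unique _ b t<N (inj₂ (trans (cong (_+ t) (toℕ-fromℕ< r<N)) (m∸n+n≡m t≤b+N)))
    where
    t≤b+N : t ≤ toℕ b + N
    t≤b+N = ≤-trans (<⇒≤ t<N) (m≤n+m N (toℕ b))
    r<N : toℕ b + N ∸ t < N
    r<N = +-cancelʳ-< t _ N (subst₂ _<_ (sym (m∸n+n≡m t≤b+N)) (+-comm t N) (+-monoˡ-< N (≰⇒> t≰b)))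

  dist-triangle : ∀ a c b → dist a c + dist c b ≡ dist a b ⊎ dist a c + dist c b ≡ dist a b + N
  dist-triangle a c b = compare (dist-wraps a b) two-laps
    where
    u = dist a c + dist c b
    x = toℕ a
    y = toℕ b
    +-comm-lap : ∀ z → z + N + dist c b ≡ z + dist c b + N
    +-comm-lap z = trans (+-assoc z N _) (trans (cong (z +_) (+-comm N _)) (sym (+-assoc z _ N)))
    two-laps : x + u ≡ y ⊎ x + u ≡ y + N ⊎ x + u ≡ y + N + N
    two-laps with dist-wraps a c | dist-wraps c b
    ... | inj₁ p | inj₁ q = inj₁ (trans (sym (+-assoc x _ _)) (trans (cong (_+ dist c b) p) q))
    ... | inj₁ p | inj₂ q = inj₂ (inj₁ (trans (sym (+-assoc x _ _)) (trans (cong (_+ dist c b) p) q)))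
    ... | inj₂ p | inj₁ q = inj₂ (inj₁ (trans (sym (+-assoc x _ _)) (trans (cong (_+ dist c b) p) (trans (+-comm-lap (toℕ c)) (cong (_+ N) q)))))
    ... | inj₂ p | inj₂ q = inj₂ (inj₂ (trans (sym (+-assoc x _ _)) (trans (cong (_+ dist c b) p) (trans (+-comm-lap (toℕ c)) (cong (_+ N) q)))))
    u<N+N : u < N + N
    u<N+N = +-mono-< (dist<N a c) (dist<N c b)
    d = dist a b
    d<N = dist<N a b
    compare : Wraps (x + d) y → x + u ≡ y ⊎ x + u ≡ y + N ⊎ x + u ≡ y + N + N → u ≡ d ⊎ u ≡ d + N
    compare (inj₁ e') (inj₁ e)        = inj₁ (+-cancelˡ-≡ x u d (trans e (sym e')))
    compare (inj₂ e') (inj₁ e)        = ⊥-elim (<N⇒≢+N d<N (+-cancel-shift x u d N (trans e' (cong (_+ N) (sym e)))))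
    compare (inj₁ e') (inj₂ (inj₁ e)) = inj₂ (+-cancel-shift x d u N (trans e (cong (_+ N) (sym e'))))
    compare (inj₂ e') (inj₂ (inj₁ e)) = inj₁ (+-cancelˡ-≡ x u d (trans e (sym e')))
    compare (inj₁ e') (inj₂ (inj₂ e)) = ⊥-elim (<-irrefl refl (≤-trans u<N+N (subst (N + N ≤_) (sym u≡) (m≤n+m (N + N) d))))
      where
      u≡ : u ≡ d + (N + N)
      u≡ = +-cancel-shift x d u (N + N) (trans e (trans (+-assoc y N N) (cong (_+ (N + N)) (sym e'))))
    compare (inj₂ e') (inj₂ (inj₂ e)) = inj₂ (+-cancel-shift x d u N (trans e (cong (_+ N) (sym e'))))

module CrownOrder (n k : ℕ) (0<n : 0 < n) where

  N : ℕ
  N = n + k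

  open CyclicDistance N public

  k<N : k < N
  k<N = +-monoˡ-≤ k 0<n

  Inc⇒dist≤k : ∀ {a b} → Inc n k a b → dist a b ≤ k
  Inc⇒dist≤k {a} {b} (t , t≤k , w) = subst (_≤ k) (sym (dist-unique a b (≤-<-trans t≤k k<N) w)) t≤k

  dist≤k⇒Inc : ∀ {a b} → dist a b ≤ k → Inc n k a b
  dist≤k⇒Inc {a} {b} d≤k = dist a b , d≤k , dist-wraps a b

  Inc? : ∀ a b → Dec (Inc n k a b)
  Inc? a b with dist a b ≤? k
  ... | yes d≤k = yes (dist≤k⇒Inc d≤k)
  ... | no  d≰k = no (d≰k ∘ Inc⇒dist≤k)

  _≺_ : Fin N → Fin N → Set
  a ≺ b = ¬ Inc n k a b

  _≺?_ : ∀ a b → Dec (a ≺ b)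
  a ≺? b = ¬? (Inc? a b)

  window⇒≺ : ∀ {a b} s → k < dist a s + dist s b → dist a s + dist s b < N → a ≺ b
  window⇒≺ {a} {b} s k< <N inc with dist-triangle a s b
  ... | inj₁ e = <-irrefl refl (≤-<-trans (Inc⇒dist≤k inc) (subst (k <_) e k<))
  ... | inj₂ e = <-irrefl refl (≤-trans <N (subst (N ≤_) (sym e) (m≤n+m N (dist a b))))

  ≺⇒window : ∀ {a b} s → dist a s ≤ k → a ≺ b → k < dist a s + dist s b × dist a s + dist s b < N
  ≺⇒window {a} {b} s as≤k a≺b with dist a b ≤? k
  ... | yes ab≤k = ⊥-elim (a≺b (dist≤k⇒Inc ab≤k))
  ... | no  ab≰k with dist-triangle a s b
  ...   | inj₁ e = subst (k <_) (sym e) (≰⇒> ab≰k) , subst (_< N) (sym e) (dist<N a b)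
  ...   | inj₂ e = ⊥-elim (ab≰k (<⇒≤ (+-cancelʳ-< N (dist a b) k
                     (subst (_< k + N) e (+-mono-≤-< as≤k (dist<N s b))))))

  arc-size : ∀ c L → L ≤ N → ∣ subset (λ b → dist c b <? L) ∣ ≡ L
  arc-size c zero _ = trans (⊆-antisym⇒∣∣≡ empty (⊆-min _)) (∣⊥∣≡0 N)
    where
    empty : subset (λ b → dist c b <? 0) ⊆ ∅
    empty b∈ with ∈-subset⁻ (λ b → dist c b <? 0) b∈
    ... | ()
  arc-size c (suc L) 1+L≤N =
    begin
      ∣ subset (λ b → dist c b <? suc L) ∣                ≡⟨ ∣∣-partition _ _ ⁅ e ⁆ cover shorter⊆ endpoint⊆ endpoint∉ ⟩
      ∣ subset (λ b → dist c b <? L) ∣ + ∣ ⁅ e ⁆ ∣        ≡⟨ cong₂ _+_ (arc-size c L (<⇒≤ 1+L≤N)) (∣⁅x⁆∣≡1 e) ⟩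
      L + 1                                              ≡⟨ +-comm L 1 ⟩
      suc L                                              ∎
    where
    open ≡-Reasoning
    endpoint = dist-surjectiveʳ c 1+L≤N
    e = proj₁ endpoint
    cover : ∀ {b} → b ∈ subset (λ b → dist c b <? suc L) → b ∈ subset (λ b → dist c b <? L) ⊎ b ∈ ⁅ e ⁆
    cover {b} b∈ with m≤n⇒m<n∨m≡n (≤-pred (∈-subset⁻ (λ b → dist c b <? suc L) b∈))
    ... | inj₁ d<L = inj₁ (∈-subset⁺ (λ b → dist c b <? L) d<L)
    ... | inj₂ d≡L = inj₂ (subst (_∈ ⁅ e ⁆) (dist-injectiveʳ c (trans (proj₂ endpoint) (sym d≡L))) (x∈⁅x⁆ e))
    shorter⊆ : subset (λ b → dist c b <? L) ⊆ subset (λ b → dist c b <? suc L)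
    shorter⊆ b∈ = ∈-subset⁺ (λ b → dist c b <? suc L) (m≤n⇒m≤1+n (∈-subset⁻ (λ b → dist c b <? L) b∈))
    endpoint⊆ : ⁅ e ⁆ ⊆ subset (λ b → dist c b <? suc L)
    endpoint⊆ b∈ rewrite x∈⁅y⁆⇒x≡y e b∈ = ∈-subset⁺ (λ b → dist c b <? suc L) (≤-reflexive (cong suc (proj₂ endpoint)))
    endpoint∉ : ∀ {b} → b ∈ subset (λ b → dist c b <? L) → ¬ b ∈ ⁅ e ⁆
    endpoint∉ b∈ b∈e rewrite x∈⁅y⁆⇒x≡y e b∈e = <-irrefl (proj₂ endpoint) (∈-subset⁻ (λ b → dist c b <? L) b∈)

  ∣Inc∣≡1+k : ∀ a → ∣ subset (Inc? a) ∣ ≡ suc k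
  ∣Inc∣≡1+k a = trans (⊆-antisym⇒∣∣≡ to-arc from-arc) (arc-size a (suc k) k<N)
    where
    to-arc : subset (Inc? a) ⊆ subset (λ b → dist a b <? suc k)
    to-arc b∈ = ∈-subset⁺ (λ b → dist a b <? suc k) (s≤s (Inc⇒dist≤k (∈-subset⁻ (Inc? a) b∈)))
    from-arc : subset (λ b → dist a b <? suc k) ⊆ subset (Inc? a)
    from-arc b∈ = ∈-subset⁺ (Inc? a) (dist≤k⇒Inc (≤-pred (∈-subset⁻ (λ b → dist a b <? suc k) b∈)))

  1+∣≻∣≡n : ∀ a → suc ∣ subset (a ≺?_) ∣ ≡ n
  1+∣≻∣≡n a = +-cancelʳ-≡ k (suc c) n (begin
      suc c + k                       ≡⟨ +-suc c k ⟨
      c + suc k                       ≡⟨ +-comm c (suc k) ⟩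
      suc k + c                       ≡⟨ cong (_+ c) (∣Inc∣≡1+k a) ⟨
      ∣ subset (Inc? a) ∣ + c         ≡⟨ ∣∣-partition (⊤ₛ {N}) _ _ split (λ _ → ∈⊤) (λ _ → ∈⊤) disjoint ⟨
      ∣ ⊤ₛ {N} ∣                       ≡⟨ ∣⊤∣≡n N ⟩
      n + k                           ∎)
    where
    open ≡-Reasoning
    c = ∣ subset (a ≺?_) ∣
    split : ∀ {b} → b ∈ ⊤ₛ {N} → b ∈ subset (Inc? a) ⊎ b ∈ subset (a ≺?_)
    split {b} _ with Inc? a b
    ... | yes inc = inj₁ (∈-subset⁺ (Inc? a) inc)
    ... | no  a≺b = inj₂ (∈-subset⁺ (a ≺?_) a≺b)
    disjoint : ∀ {b} → b ∈ subset (Inc? a) → ¬ b ∈ subset (a ≺?_)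
    disjoint inc a≺b = ∈-subset⁻ (a ≺?_) a≺b (∈-subset⁻ (Inc? a) inc)

  module Ranking (ρ : Fin N → ℕ) (ρ-injective : Injective _≡_ _≡_ ρ) where

    Clears : Fin N → Fin N → Set
    Clears a b = ∀ a' → a' ≺ b → ρ a' < ρ a

    Clears? : ∀ a b → Dec (Clears a b)
    Clears? a b = all? (λ a' → (a' ≺? b) →-dec (ρ a' <? ρ a))

    cleared : RSet n k
    cleared a = subset (Clears? a)

    height : Fin N → ℕ
    height b = max 0 (List.map (suc ∘ ρ) (filter (_≺? b) (allFin N)))

    ρ<height : ∀ {a b} → a ≺ b → suc (ρ a) ≤ height b
    ρ<height {a} {b} a≺b =
      v≤max⁺ 0 _ (inj₂ (Any.map ≤-reflexive (∈-map⁺ (suc ∘ ρ) (∈-filter⁺ (_≺? b) (∈-allFin a) a≺b))))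

    height≤ρ : ∀ {a b} → Clears a b → height b ≤ ρ a
    height≤ρ {a} {b} clears = max≤v⁺ z≤n (map⁺ (All.map (clears _) (all-filter (_≺? b) (allFin N))))

    offset level : Elt N → ℕ
    offset (inj₁ a) = 0
    offset (inj₂ b) = suc (toℕ b)
    level (inj₁ a) = suc (ρ a)
    level (inj₂ b) = height b

    offset<1+N : ∀ x → offset x < suc N
    offset<1+N (inj₁ a) = s≤s z≤n
    offset<1+N (inj₂ b) = s≤s (toℕ<n b)

    position : Elt N → ℕ
    position x = offset x + level x * suc N

    position-injective : Injective _≡_ _≡_ position
    position-injective {x} {y} e with remainder-quotient-injective (suc N) {offset x} {offset y} {level x} {level y}
                                        (offset<1+N x) (offset<1+N y) e
    position-injective {inj₁ a} {inj₁ a'} e | _ , same-level = cong inj₁ (ρ-injective (suc-injective same-level))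
    position-injective {inj₂ b} {inj₂ b'} e | same-offset , _ = cong inj₂ (toℕ-injective (suc-injective same-offset))
    position-injective {inj₁ a} {inj₂ b'} e | () , _
    position-injective {inj₂ b} {inj₁ a'} e | () , _

    position-order : ∀ a b → a ≺ b → position (inj₁ a) < position (inj₂ b)
    position-order a b a≺b = begin-strict
      suc (ρ a) * suc N              ≤⟨ *-monoˡ-≤ (suc N) (ρ<height a≺b) ⟩
      height b * suc N               <⟨ m<n+m _ (s≤s z≤n) ⟩
      suc (toℕ b) + height b * suc N ∎
      where open ≤-Reasoning

    position-reverses : ∀ a b → Clears a b → position (inj₂ b) < position (inj₁ a)
    position-reverses a b clears = begin-strict
      suc (toℕ b) + height b * suc N ≤⟨ +-monoʳ-≤ (suc (toℕ b)) (*-monoˡ-≤ (suc N) (height≤ρ clears)) ⟩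
      suc (toℕ b) + ρ a * suc N      <⟨ +-monoˡ-< (ρ a * suc N) (s≤s (toℕ<n b)) ⟩
      suc (ρ a) * suc N              ∎
      where open ≤-Reasoning

    extension : LinearExtension n k
    extension = record { pos = position ; pos-inj = position-injective ; pos-order = position-order }

    cleared-reversible : Reversible n k cleared
    cleared-reversible = InInc-cleared , extension , λ a b b∈ → position-reverses a b (∈-subset⁻ (Clears? a) b∈)
      where
      InInc-cleared : InInc n k cleared
      InInc-cleared a b b∈ with Inc? a b
      ... | yes inc = inc
      ... | no  a≺b = ⊥-elim (<-irrefl refl (∈-subset⁻ (Clears? a) b∈ a a≺b))

module CrownArithmetic (n' k : ℕ) where

  n N : ℕ
  n = suc (suc (suc n'))
  N = n + k

  -- Relative to a base point s, the element of A at t = dist a s ≤ k lies below the element of B at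
  -- v = dist s b exactly when t ⋖ v; Clear t v is its negation.
  _⋖_ : ℕ → ℕ → Set
  t ⋖ v = k < t + v × t + v < N

  Clear : ℕ → ℕ → Set
  Clear t v = t + v ≤ k ⊎ N ≤ t + v

  ClearOf : ℕ → ℕ → ℕ → Set
  ClearOf lo hi v = v + hi ≤ k ⊎ N ≤ v + lo

  Apart : ℕ → ℕ → ℕ → Set
  Apart em lo hi = em + n ≤ lo ⊎ hi + n ≤ em

  1+t<t+n : ∀ t → suc t < t + n
  1+t<t+n t = subst (_< t + n) (+-comm t 1) (+-monoʳ-< t (s≤s (s≤s z≤n)))

  ∃-first-above : ∀ {t} → t ≤ k → ∃[ v ] v < N × t ⋖ v × (∀ {u} → u < t → u + v ≤ k)
  ∃-first-above {t} t≤k with m≤n⇒∃[o]m+o≡n t≤k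
  ... | c , refl = suc c ,
      +≡⇒≤ (suc n' + t) (solve (n' ∷ c ∷ t ∷ [])) ,
      (+≡⇒≤ 0 (solve (c ∷ t ∷ [])) , +≡⇒≤ (suc n') (solve (n' ∷ c ∷ t ∷ []))) ,
      λ {u} u<t → ≤-trans (≤-reflexive (+-suc u c)) (+-monoˡ-≤ c u<t)

  ∃-last-above : ∀ {t} → t ≤ k → ∃[ v ] v < N × t ⋖ v × (∀ {u} → t < u → N ≤ u + v)
  ∃-last-above {t} t≤k with m≤n⇒∃[o]m+o≡n t≤k
  ... | c , refl = suc (suc (n' + c)) ,
      +≡⇒≤ t (solve (n' ∷ c ∷ t ∷ [])) ,
      (+≡⇒≤ (suc n') (solve (n' ∷ c ∷ t ∷ [])) , +≡⇒≤ 0 (solve (n' ∷ c ∷ t ∷ []))) ,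
      λ {u} t<u → ≤-by-shift (suc (suc (n' + c))) 0 0 t<u (solve (n' ∷ c ∷ t ∷ [])) (solve (n' ∷ c ∷ u ∷ []))

  ∃-left-edge : ∀ {t lo} → lo ≤ k → t < lo → lo < t + n → ∃[ v ] v < N × v + lo ≡ N × t ⋖ v
  ∃-left-edge {t} {lo} lo≤k t<lo lo<t+n with m≤n⇒∃[o]m+o≡n lo≤k
  ... | c , refl = n + c ,
      +-monoʳ-< n (m<n+m c (≤-trans (s≤s z≤n) t<lo)) ,
      trans (+-assoc n c lo) (cong (n +_) (+-comm c lo)) ,
      (≤-trans (+-monoˡ-< c lo<t+n) (≤-reflexive (+-assoc t n c)) ,
       ≤-trans (≤-reflexive (cong suc (trans (sym (+-assoc t n c)) (trans (cong (_+ c) (+-comm t n)) (+-assoc n t c)))))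
               (+-monoʳ-< n (+-monoˡ-< c t<lo)))

  ∃-right-edge : ∀ {t hi} → t ≤ k → hi < t → t < hi + n → ∃[ v ] v < N × v + hi ≡ k × t ⋖ v
  ∃-right-edge {t} {hi} t≤k hi<t t<hi+n with m≤n⇒∃[o]m+o≡n (≤-trans (<⇒≤ hi<t) t≤k)
  ... | c , refl = c ,
      ≤-<-trans (m≤n+m c hi) (m<n+m (hi + c) {n} (s≤s z≤n)) ,
      +-comm c hi ,
      (+-monoˡ-< c hi<t ,
       ≤-trans (+-monoˡ-≤ c t<hi+n) (≤-reflexive (trans (cong (_+ c) (+-comm hi n)) (+-assoc n hi c))))

  left-edge-unique : ∀ {em lo v} → suc em ≡ lo → em ⋖ v → ¬ lo ⋖ v → v + lo ≡ N
  left-edge-unique {em} {_} {v} refl (k<em+v , em+v<N) lo⋖̸v with suc em + v <? N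
  ... | yes lo+v<N = ⊥-elim (lo⋖̸v (≤-trans k<em+v (n≤1+n _) , lo+v<N))
  ... | no  lo+v≮N = trans (+-comm v (suc em)) (≤-antisym em+v<N (≮⇒≥ lo+v≮N))

  right-edge-unique : ∀ {em hi v} → em ≡ suc hi → em ⋖ v → ¬ hi ⋖ v → v + hi ≡ k
  right-edge-unique {_} {hi} {v} refl (k<em+v , em+v<N) hi⋖̸v with k <? hi + v
  ... | yes k<hi+v = ⊥-elim (hi⋖̸v (k<hi+v , <-trans (n<1+n _) em+v<N))
  ... | no  k≮hi+v = trans (+-comm v hi) (≤-antisym (≮⇒≥ k≮hi+v) (≤-pred k<em+v))

  ∃-above-clear-of : ∀ {lo hi t} → hi ≤ k → t ≤ k → t < lo ⊎ hi < t → ∃[ v ] v < N × t ⋖ v × ClearOf lo hi v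
  ∃-above-clear-of {lo} {hi} {t} _ t≤k (inj₁ t<lo) with ∃-last-above t≤k
  ... | v , v<N , t⋖v , beyond = v , v<N , t⋖v , inj₂ (≤-trans (beyond t<lo) (≤-reflexive (+-comm lo v)))
  ∃-above-clear-of {lo} {hi} {t} _ t≤k (inj₂ hi<t) with ∃-first-above t≤k
  ... | v , v<N , t⋖v , before = v , v<N , t⋖v , inj₁ (≤-trans (≤-reflexive (+-comm v hi)) (before hi<t))

  ∃-above-clear-of-avoiding : ∀ {lo hi em t} → lo ≤ hi → hi ≤ k → t ≤ k → t < lo ⊎ hi < t → t ≢ em →
                              Apart em lo hi → ∃[ v ] v < N × t ⋖ v × ClearOf lo hi v × Clear em v
  ∃-above-clear-of-avoiding {lo} {hi} {em} {t} lo≤hi hi≤k t≤k t-outside t≢em em-apart with ≢⇒<⊎> t≢em | t-outside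
  ... | inj₁ t<em | inj₁ t<lo with ∃-last-above t≤k
  ...   | v , v<N , t⋖v , beyond = v , v<N , t⋖v , inj₂ (≤-trans (beyond t<lo) (≤-reflexive (+-comm lo v))) , inj₂ (beyond t<em)
  ∃-above-clear-of-avoiding {lo} {hi} {em} {t} lo≤hi hi≤k t≤k t-outside t≢em em-apart | inj₂ em<t | inj₂ hi<t
    with ∃-first-above t≤k
  ...   | v , v<N , t⋖v , before = v , v<N , t⋖v , inj₁ (≤-trans (≤-reflexive (+-comm v hi)) (before hi<t)) , inj₁ (before em<t)
  ∃-above-clear-of-avoiding {lo} {hi} {em} {t} lo≤hi hi≤k t≤k t-outside t≢em em-apart | inj₂ em<t | inj₁ t<lo =
    between-left em-apart
    where
    between-left : Apart em lo hi → ∃[ v ] v < N × t ⋖ v × ClearOf lo hi v × Clear em v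
    between-left (inj₂ hi+n≤em) = ⊥-elim (<⇒≱ em<t (≤-trans (<⇒≤ t<lo) (≤-trans lo≤hi (≤-trans (m≤m+n hi n) hi+n≤em))))
    between-left (inj₁ em+n≤lo) with lo <? t + n
    ... | yes lo<t+n with ∃-left-edge (≤-trans lo≤hi hi≤k) t<lo lo<t+n
    ...   | v , v<N , v+lo≡N , t⋖v = v , v<N , t⋖v , inj₂ (≤-reflexive (sym v+lo≡N)) ,
          inj₁ (+-cancelʳ-≤ n (em + v) k (begin
            em + v + n     ≡⟨ trans (cong (_+ n) (+-comm em v)) (+-assoc v em n) ⟩
            v + (em + n)   ≤⟨ +-monoʳ-≤ v em+n≤lo ⟩
            v + lo         ≡⟨ trans v+lo≡N (+-comm n k) ⟩
            k + n          ∎))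
      where open ≤-Reasoning
    between-left (inj₁ em+n≤lo) | no lo≮t+n with ∃-first-above t≤k
    ...   | v , v<N , t⋖v@(k<t+v , _) , before = v , v<N , t⋖v , inj₂ (<⇒≤ (begin-strict
            n + k          <⟨ +-monoʳ-< n k<t+v ⟩
            n + (t + v)    ≡⟨ trans (sym (+-assoc n t v)) (cong (_+ v) (+-comm n t)) ⟩
            t + n + v      ≤⟨ +-monoˡ-≤ v (≮⇒≥ lo≮t+n) ⟩
            lo + v         ≡⟨ +-comm lo v ⟩
            v + lo         ∎)) , inj₁ (before em<t)
      where open ≤-Reasoning
  ∃-above-clear-of-avoiding {lo} {hi} {em} {t} lo≤hi hi≤k t≤k t-outside t≢em em-apart | inj₁ t<em | inj₂ hi<t =
    between-right em-apart
    where
    between-right : Apart em lo hi → ∃[ v ] v < N × t ⋖ v × ClearOf lo hi v × Clear em v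
    between-right (inj₁ em+n≤lo) = ⊥-elim (<⇒≱ t<em (≤-trans (m≤m+n em n) (≤-trans em+n≤lo (≤-trans lo≤hi (<⇒≤ hi<t)))))
    between-right (inj₂ hi+n≤em) with t <? hi + n
    ... | yes t<hi+n with ∃-right-edge t≤k hi<t t<hi+n
    ...   | v , v<N , v+hi≡k , t⋖v = v , v<N , t⋖v , inj₁ (≤-reflexive v+hi≡k) ,
          inj₂ (begin
            n + k          ≡⟨ cong (n +_) (sym v+hi≡k) ⟩
            n + (v + hi)   ≡⟨ trans (cong (n +_) (+-comm v hi)) (trans (sym (+-assoc n hi v)) (cong (_+ v) (+-comm n hi))) ⟩
            hi + n + v     ≤⟨ +-monoˡ-≤ v hi+n≤em ⟩
            em + v         ∎)
      where open ≤-Reasoning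
    between-right (inj₂ hi+n≤em) | no t≮hi+n with ∃-last-above t≤k
    ...   | v , v<N , t⋖v@(_ , t+v<N) , beyond = v , v<N , t⋖v , inj₁ (<⇒≤ (+-cancelˡ-< n (v + hi) k (begin-strict
            n + (v + hi)      ≡⟨ trans (cong (n +_) (+-comm v hi)) (trans (sym (+-assoc n hi v)) (cong (_+ v) (+-comm n hi))) ⟩
            hi + n + v        ≤⟨ +-monoˡ-≤ v (≮⇒≥ t≮hi+n) ⟩
            t + v             <⟨ t+v<N ⟩
            n + k             ∎))) , inj₂ (beyond t<em)
      where open ≤-Reasoning

  apart-⋖⇒clear-of : ∀ {em lo hi v} → Apart em lo hi → em ⋖ v → ClearOf lo hi v
  apart-⋖⇒clear-of {em} {lo} {hi} {v} (inj₁ em+n≤lo) (k<em+v , _) = inj₂ (≤-trans N≤em+v+n-1 em+v+n-1≤v+lo)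
    where
    em+v+n-1≤v+lo : em + v + suc (suc n') ≤ v + lo
    em+v+n-1≤v+lo = ≤-by-shift {a = em + suc (suc (suc n'))} v 1 0 em+n≤lo (solve (n' ∷ em ∷ v ∷ [])) (solve (v ∷ lo ∷ []))
    N≤em+v+n-1 : suc (suc (suc n')) + k ≤ em + v + suc (suc n')
    N≤em+v+n-1 = ≤-by-shift (suc (suc n')) 0 0 k<em+v (solve (n' ∷ k ∷ [])) (solve (n' ∷ em ∷ v ∷ []))
  apart-⋖⇒clear-of {em} {lo} {hi} {v} (inj₂ hi+n≤em) (_ , em+v<N) = inj₁ (+-cancelˡ-≤ n _ _ (≤-trans n+v+hi≤em+v (<⇒≤ em+v<N)))
    where
    n+v+hi≤em+v : suc (suc (suc n')) + (v + hi) ≤ em + v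
    n+v+hi≤em+v = ≤-by-shift {a = hi + suc (suc (suc n'))} v 0 0 hi+n≤em (solve (n' ∷ v ∷ hi ∷ [])) (solve (em ∷ v ∷ []))

  left-swap-⋖ : ∀ {em ly v} → suc em ≤ ly → suc ly < em + n → ly ⋖ v → suc ly ⋖ v ⊎ em ⋖ v
  left-swap-⋖ {em} {ly} {v} em<ly ly+1<em+n (k<ly+v , ly+v<N) with suc ly + v <? N
  ... | yes ly+1+v<N = inj₁ (≤-trans k<ly+v (n≤1+n _) , ly+1+v<N)
  ... | no  ly+1+v≮N = inj₂ (k<em+v , ≤-<-trans (+-monoˡ-≤ v (≤-trans (n≤1+n _) em<ly)) ly+v<N)
    where
    ly+1+v≡N : suc ly + v ≡ N
    ly+1+v≡N = ≤-antisym ly+v<N (≮⇒≥ ly+1+v≮N)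
    k<em+v : k < em + v
    k<em+v = +-cancelˡ-< (suc (suc (suc n'))) k (em + v)
               (≤-by-shift {b = em + suc (suc (suc n'))} v 0 0 ly+1<em+n
                           (trans (+-identityʳ _) (cong suc (sym ly+1+v≡N))) (solve (n' ∷ em ∷ v ∷ [])))

  right-swap-⋖ : ∀ {em hi v} → suc hi < em → em < hi + n → suc hi ⋖ v → hi ⋖ v ⊎ em ⋖ v
  right-swap-⋖ {em} {hi} {v} hi+1<em em<hi+n (k<hi+1+v , hi+1+v<N) with k <? hi + v
  ... | yes k<hi+v = inj₁ (k<hi+v , <-trans (n<1+n _) hi+1+v<N)
  ... | no  k≮hi+v = inj₂ (≤-trans k<hi+1+v (+-monoˡ-≤ v (≤-trans (n≤1+n _) hi+1<em)) ,
                           ≤-trans (+-monoˡ-≤ v em<hi+n)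
                                   (≤-reflexive (trans (cong (_+ v) (+-comm hi n)) (trans (+-assoc n hi v) (cong (n +_) hi+v≡k)))))
    where
    hi+v≡k : hi + v ≡ k
    hi+v≡k = ≤-antisym (≮⇒≥ k≮hi+v) (≤-pred k<hi+1+v)

  clear-of⇒clear : ∀ {lo hi t v} → lo ≤ t → t ≤ hi → ClearOf lo hi v → Clear t v
  clear-of⇒clear {lo} {hi} {t} {v} _    t≤hi (inj₁ v+hi≤k) = inj₁ (≤-trans (≤-reflexive (+-comm t v)) (≤-trans (+-monoʳ-≤ v t≤hi) v+hi≤k))
  clear-of⇒clear {lo} {hi} {t} {v} lo≤t _    (inj₂ N≤v+lo) = inj₂ (≤-trans N≤v+lo (≤-trans (+-monoʳ-≤ v lo≤t) (≤-reflexive (+-comm v t))))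

  ⋖⇒¬clear : ∀ {t v} → t ⋖ v → ¬ Clear t v
  ⋖⇒¬clear (k<t+v , _)   (inj₁ t+v≤k) = <⇒≱ k<t+v t+v≤k
  ⋖⇒¬clear (_ , t+v<N)   (inj₂ N≤t+v) = <⇒≱ t+v<N N≤t+v

  clear-of-mono : ∀ {lo hi lo' hi' v} → lo' ≤ lo → hi ≤ hi' → ClearOf lo' hi' v → ClearOf lo hi v
  clear-of-mono {v = v} _     hi≤hi' (inj₁ v+hi'≤k) = inj₁ (≤-trans (+-monoʳ-≤ v hi≤hi') v+hi'≤k)
  clear-of-mono {v = v} lo'≤lo _     (inj₂ N≤v+lo') = inj₂ (≤-trans N≤v+lo' (+-monoʳ-≤ v lo'≤lo))

  apart⇒j+n≤k : ∀ {em lo hi j} → Apart em lo hi → hi ≡ lo + j → hi ≤ k → em ≤ k → j + n ≤ k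
  apart⇒j+n≤k {em} {lo} {hi} {j} (inj₁ em+n≤lo) refl hi≤k _ =
    ≤-trans (≤-reflexive (+-comm j n)) (≤-trans (+-monoˡ-≤ j (≤-trans (m≤n+m n em) em+n≤lo)) hi≤k)
  apart⇒j+n≤k {em} {lo} {hi} {j} (inj₂ hi+n≤em) refl _ em≤k =
    ≤-trans (+-monoˡ-≤ n (m≤n+m j lo)) (≤-trans hi+n≤em em≤k)

  distant-size : ∀ {X Y j} → suc Y ≡ X + n → Y + suc j ≡ k + 2 → X + suc (suc j) + n ≡ k + 4
  distant-size {X} {Y} {j} 1+Y≡X+n Y+1+j≡k+2 = begin
    X + suc (suc j) + suc (suc (suc n'))   ≡⟨ solve (n' ∷ X ∷ j ∷ []) ⟩
    (X + suc (suc (suc n'))) + suc (suc j) ≡⟨ cong (_+ suc (suc j)) 1+Y≡X+n ⟨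
    suc Y + suc (suc j)   ≡⟨ solve (Y ∷ j ∷ []) ⟩
    (Y + suc j) + 2       ≡⟨ cong (_+ 2) Y+1+j≡k+2 ⟩
    k + 2 + 2             ≡⟨ solve (k ∷ []) ⟩
    k + 4                 ∎
    where open ≡-Reasoning

  distant-breaks-staircase : ∀ {X Y j} → suc Y ≡ X + n → Y + suc j ≡ k + 2 → X + suc (suc j) ≢ k + 2
  distant-breaks-staircase {X} {Y} {j} 1+Y≡X+n Y+1+j≡k+2 X+2+j≡k+2 = 1+n≰n (begin
    suc (suc (suc X))          ≤⟨ m≤m+n (suc (suc (suc X))) n' ⟩
    suc (suc (suc X)) + n'     ≡⟨ solve (n' ∷ X ∷ []) ⟩
    X + suc (suc (suc n'))     ≡⟨ 1+Y≡X+n ⟨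
    suc Y                      ≡⟨ cong suc Y≡1+X ⟩
    suc (suc X)                ∎)
    where
    open ≤-Reasoning
    Y≡1+X : Y ≡ suc X
    Y≡1+X = +-cancelʳ-≡ (suc j) Y (suc X) (trans Y+1+j≡k+2 (trans (sym X+2+j≡k+2) (+-suc X (suc j))))

  adjacent-size : ∀ {X Y j} → Y ≡ X + 1 → Y + suc j ≡ k + 2 → X + suc (suc j) ≡ k + 2
  adjacent-size {X} {Y} {j} refl Y+1+j≡k+2 = trans (sym (+-assoc X 1 (suc j))) Y+1+j≡k+2

  smaller-size : ∀ {X' X a b} → X' < X → X + a + b ≡ k + 4 → X' + a + b ≤ k + 3
  smaller-size {X'} {X} {a} {b} X'<X eq = ≤-pred (≤-trans (+-monoˡ-< b (+-monoˡ-< a X'<X)) (≤-reflexive (trans eq (+-suc k 3))))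

module MaximalReversible (n' k : ℕ) (R : RSet (suc (suc (suc n'))) k)
                         (R-max : MaxReversible (suc (suc (suc n'))) k R) where

  open CrownArithmetic n' k hiding (N)
  open CrownOrder n k (s≤s z≤n)

  L : LinearExtension n k
  L = proj₁ (proj₂ (proj₁ R-max))

  P : Fin N → ℕ
  P a = pos L (inj₁ a)

  P-injective : Injective _≡_ _≡_ P
  P-injective = inj₁-injective ∘ pos-inj L

  ∈R⇒P-clears : ∀ {a b} → b ∈ R a → ∀ a' → a' ≺ b → P a' < P a
  ∈R⇒P-clears {a} {b} b∈Ra a' a'≺b = <-trans (pos-order L a' b a'≺b) (proj₂ (proj₂ (proj₁ R-max)) a b b∈Ra)

  cleared⊆R : ∀ (ρ : Fin N → ℕ) (ρ-injective : Injective _≡_ _≡_ ρ) → let open Ranking ρ ρ-injective in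
              (∀ {a b} → b ∈ R a → Clears a b) → ∀ {a b} → Clears a b → b ∈ R a
  cleared⊆R ρ ρ-injective R-clears {a} clears =
    proj₂ R-max cleared cleared-reversible (λ a b∈Ra → ∈-subset⁺ (Clears? a) (R-clears b∈Ra)) a (∈-subset⁺ (Clears? a) clears)
    where open Ranking ρ ρ-injective

  P-clears⇒∈R : ∀ {a b} → (∀ a' → a' ≺ b → P a' < P a) → b ∈ R a
  P-clears⇒∈R = cleared⊆R P P-injective ∈R⇒P-clears

  R-mono : ∀ {a a'} → P a ≤ P a' → R a ⊆ R a'
  R-mono P≤ b∈ = P-clears⇒∈R (λ a″ a″≺b → <-≤-trans (∈R⇒P-clears b∈ a″ a″≺b) P≤)

  module Promotion {m y : Fin N} (Py<Pm : P y < P m) where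

    promoted : Fin N → ℕ
    promoted a with a ≟ᶠ y
    ... | yes _ = 1 + P m * 2
    ... | no  _ = 0 + P a * 2

    promoted-y : promoted y ≡ 1 + P m * 2
    promoted-y with y ≟ᶠ y
    ... | yes _  = refl
    ... | no y≢y = ⊥-elim (y≢y refl)

    promoted-≢ : ∀ {a} → a ≢ y → promoted a ≡ 0 + P a * 2
    promoted-≢ {a} a≢y with a ≟ᶠ y
    ... | yes a≡y = ⊥-elim (a≢y a≡y)
    ... | no  _   = refl

    promoted-injective : Injective _≡_ _≡_ promoted
    promoted-injective {a} {a'} eq with a ≟ᶠ y | a' ≟ᶠ y
    ... | yes a≡y | yes a'≡y = trans a≡y (sym a'≡y)
    ... | yes _   | no  _    with remainder-quotient-injective 2 {1} {0} {P m} {P a'} (s≤s (s≤s z≤n)) (s≤s z≤n) eq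
    ...   | () , _
    promoted-injective {a} {a'} eq | no _ | yes _ with remainder-quotient-injective 2 {0} {1} {P a} {P m} (s≤s z≤n) (s≤s (s≤s z≤n)) eq
    ...   | () , _
    promoted-injective {a} {a'} eq | no _ | no _ =
      P-injective (proj₂ (remainder-quotient-injective 2 {0} {0} {P a} {P a'} (s≤s z≤n) (s≤s z≤n) eq))

    promoted-< : ∀ {a' a} → Dec (a' ≡ y) → Dec (a ≡ y) → (a' ≡ y → a ≢ y → P m < P a) → P a' < P a →
                 promoted a' < promoted a
    promoted-< (yes refl) (yes refl) _ Pa'<Pa = ⊥-elim (<-irrefl refl Pa'<Pa)
    promoted-< (no  a'≢y) (yes refl) _ Pa'<Pa =
      subst₂ _<_ (sym (promoted-≢ a'≢y)) (sym promoted-y) (<-scaled 0 1 z≤n (<-trans Pa'<Pa Py<Pm))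
    promoted-< (yes refl) (no  a≢y) Pm<Pa _ =
      subst₂ _<_ (sym promoted-y) (sym (promoted-≢ a≢y)) (<-scaled 1 0 ≤-refl (Pm<Pa refl a≢y))
    promoted-< (no  a'≢y) (no  a≢y) _ Pa'<Pa =
      subst₂ _<_ (sym (promoted-≢ a'≢y)) (sym (promoted-≢ a≢y)) (<-scaled 0 0 z≤n Pa'<Pa)

    promoted-≤ : ∀ {a} → a ≢ y → P a ≤ P m → promoted a < promoted y
    promoted-≤ a≢y Pa≤Pm = subst₂ _<_ (sym (promoted-≢ a≢y)) (sym promoted-y) (s≤s (*-monoˡ-≤ 2 Pa≤Pm))

  -- Re-ranking y directly above m, below everything that was above m, would enlarge R by (y, b₀).
  ¬promotable : ∀ {m y b₀} → P y < P m →
                (∀ {a b} → y ≺ b → b ∈ R a → a ≢ y → P m < P a) →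
                m ≺ b₀ → ¬ y ≺ b₀ → (∀ {a} → a ≺ b₀ → a ≢ y → P a ≤ P m) → ⊥
  ¬promotable {m} {y} {b₀} Py<Pm above-y⇒above-m m≺b₀ y⊀b₀ below-b₀⇒below-m =
    <-asym Py<Pm (∈R⇒P-clears (cleared⊆R promoted promoted-injective R-clears y-clears-b₀) m m≺b₀)
    where
    open Promotion Py<Pm
    R-clears : ∀ {a b} → b ∈ R a → Ranking.Clears promoted promoted-injective a b
    R-clears {a} {b} b∈Ra a' a'≺b = promoted-< (a' ≟ᶠ y) (a ≟ᶠ y)
      (λ { refl a≢y → above-y⇒above-m a'≺b b∈Ra a≢y }) (∈R⇒P-clears b∈Ra a' a'≺b)
    y-clears-b₀ : Ranking.Clears promoted promoted-injective y b₀
    y-clears-b₀ a a≺b₀ = promoted-≤ a≢y (below-b₀⇒below-m a≺b₀ a≢y)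
      where
      a≢y : a ≢ y
      a≢y refl = y⊀b₀ a≺b₀

  module Labelled (x : Fin (suc k) → Fin N) (x-consistent : ConsistentLabeling n k R x) where

    x-injective : Injective _≡_ _≡_ x
    x-injective = proj₁ x-consistent

    nested : ∀ {α β} → toℕ α ≤ toℕ β → R (x β) ⊆ R (x α)
    nested {α} {β} α≤β with m≤n⇒m<n∨m≡n α≤β
    ... | inj₁ α<β = proj₂ (proj₂ x-consistent) α β α<β
    ... | inj₂ α≡β rewrite toℕ-injective {i = α} {j = β} α≡β = λ b∈ → b∈

    labelled : ∀ {a b} → b ∈ R a → ∃[ β ] x β ≡ a
    labelled {a} {b} b∈Ra = proj₁ (proj₁ (proj₂ x-consistent) a) (b , b∈Ra)

    last-nonempty : ∃[ b ] b ∈ R (x (fromℕ k))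
    last-nonempty = proj₂ (proj₁ (proj₂ x-consistent) (x (fromℕ k))) (fromℕ k , refl)

    -- Every R (x α) contains the base point s, from which all coordinates are measured.
    s : Fin N
    s = proj₁ last-nonempty

    s∈R : ∀ α → s ∈ R (x α)
    s∈R α = nested (subst (toℕ α ≤_) (sym (toℕ-fromℕ k)) (≤-pred (toℕ<n α))) (proj₂ last-nonempty)

    e : Fin N → ℕ
    e a = dist a s

    w : Fin N → ℕ
    w b = dist s b

    e≤k : ∀ {a} → s ∈ R a → e a ≤ k
    e≤k {a} s∈Ra = Inc⇒dist≤k (proj₁ (proj₁ R-max) a s s∈Ra)

    ex≤k : ∀ α → e (x α) ≤ k
    ex≤k α = e≤k (s∈R α)

    ⋖⇒≺ : ∀ {a b} → e a ⋖ w b → a ≺ b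
    ⋖⇒≺ (k< , <N) = window⇒≺ s k< <N

    ≺⇒⋖ : ∀ {a b} → e a ≤ k → a ≺ b → e a ⋖ w b
    ≺⇒⋖ = ≺⇒window s

    clear⇒⊀ : ∀ {a b} → e a ≤ k → Clear (e a) (w b) → ¬ a ≺ b
    clear⇒⊀ {a} {b} e≤ clear a≺b = ⋖⇒¬clear {e a} {w b} (≺⇒⋖ e≤ a≺b) clear

    ∃-at-w : ∀ {v} → v < N → ∃[ b ] w b ≡ v
    ∃-at-w = dist-surjectiveʳ s

    ∃-at-e : ∀ {t} → t < N → ∃[ a ] e a ≡ t
    ∃-at-e = dist-surjectiveˡ s

    e-injective : Injective _≡_ _≡_ e
    e-injective = dist-injectiveˡ s

    w-injective : Injective _≡_ _≡_ w
    w-injective = dist-injectiveʳ s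

    P-≤∧≢⇒< : ∀ {a a'} → P a ≤ P a' → a ≢ a' → P a < P a'
    P-≤∧≢⇒< P≤ a≢a' = ≤∧≢⇒< P≤ (a≢a' ∘ P-injective)

    record TopBlock (j : Fin (suc k)) : Set where
      field
        lo hi                : ℕ
        hi≡lo+j              : hi ≡ lo + toℕ j
        hi≤k                 : hi ≤ k
        above⇒in-block       : ∀ a → P (x j) ≤ P a → lo ≤ e a × e a ≤ hi
        in-block⇒above       : ∀ a → lo ≤ e a → e a ≤ hi → P (x j) ≤ P a
        earlier⇒above        : ∀ β → toℕ β ≤ toℕ j → P (x j) ≤ P (x β)
        above⇒earlier        : ∀ β → P (x j) ≤ P (x β) → toℕ β ≤ toℕ j

      lo≤hi : lo ≤ hi
      lo≤hi = subst (lo ≤_) (sym hi≡lo+j) (m≤m+n lo (toℕ j))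

      clear-of⇒∈R : ∀ {b} → ClearOf lo hi (w b) → b ∈ R (x j)
      clear-of⇒∈R {b} clear = P-clears⇒∈R below
        where
        below : ∀ a' → a' ≺ b → P a' < P (x j)
        below a' a'≺b with P a' <? P (x j)
        ... | yes P< = P<
        ... | no  P≮ with above⇒in-block a' (≮⇒≥ P≮)
        ...   | lo≤ , ≤hi = ⊥-elim (clear⇒⊀ (≤-trans ≤hi hi≤k) (clear-of⇒clear lo≤ ≤hi clear) a'≺b)

    module Top where

      top : ∃[ m₀ ] U m₀ × (∀ a → U a → P a ≤ P m₀)
      top = ∃-maximiser U? P {s} tt

      m₀ : Fin N
      m₀ = proj₁ top

      P≤Pm₀ : ∀ a → P a ≤ P m₀
      P≤Pm₀ a = proj₂ (proj₂ top) a tt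

      m₀-unique : ∀ {a} → P m₀ ≤ P a → a ≡ m₀
      m₀-unique P≤ = P-injective (≤-antisym (P≤Pm₀ _) P≤)

      R-m₀ : ∀ {b} → ¬ m₀ ≺ b → b ∈ R m₀
      R-m₀ m₀⊀b = P-clears⇒∈R λ a' a'≺b → P-≤∧≢⇒< (P≤Pm₀ a') λ { refl → m₀⊀b a'≺b }

      e-m₀≤k : e m₀ ≤ k
      e-m₀≤k = e≤k (R-mono (P≤Pm₀ (x zero)) (s∈R zero))

      ⊉R-m₀ : ∀ {a} → a ≢ m₀ → e a ≤ k → ¬ R m₀ ⊆ R a
      ⊉R-m₀ {a} a≢m₀ e-a≤k R-m₀⊆R-a
        with ∃-above-clear-of e-m₀≤k e-a≤k (≢⇒<⊎> (a≢m₀ ∘ e-injective))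
      ... | v , v<N , e-a⋖v , clear with ∃-at-w v<N
      ...   | b , refl = <-irrefl refl (∈R⇒P-clears (R-m₀⊆R-a (R-m₀ m₀⊀b)) a (⋖⇒≺ e-a⋖v))
        where
        m₀⊀b : ¬ m₀ ≺ b
        m₀⊀b = clear⇒⊀ e-m₀≤k (clear-of⇒clear {e m₀} {e m₀} {e m₀} {w b} ≤-refl ≤-refl clear)

      x₀≡m₀ : x zero ≡ m₀
      x₀≡m₀ with x zero ≟ᶠ m₀
      ... | yes x₀≡m₀ = x₀≡m₀
      ... | no  x₀≢m₀ = ⊥-elim (⊉R-m₀ x₀≢m₀ (ex≤k zero) R-m₀⊆R-x₀)
        where
        R-m₀⊆R-x₀ : R m₀ ⊆ R (x zero)
        R-m₀⊆R-x₀ with labelled (R-mono (P≤Pm₀ (x zero)) (s∈R zero))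
        ... | β , x-β≡m₀ = subst (λ a → R a ⊆ R (x zero)) x-β≡m₀ (nested z≤n)

      P-x₀≡P-m₀ : P (x zero) ≡ P m₀
      P-x₀≡P-m₀ = cong P x₀≡m₀

      top-block₀ : TopBlock zero
      top-block₀ = record
        { lo             = e m₀
        ; hi             = e m₀
        ; hi≡lo+j        = sym (+-identityʳ _)
        ; hi≤k           = e-m₀≤k
        ; above⇒in-block = λ a P≤ → let e≡ = cong e (m₀-unique (subst (_≤ P a) P-x₀≡P-m₀ P≤))
                                    in ≤-reflexive (sym e≡) , ≤-reflexive e≡
        ; in-block⇒above = λ a lo≤ ≤hi → ≤-reflexive (trans P-x₀≡P-m₀ (cong P (e-injective (≤-antisym lo≤ ≤hi))))
        ; earlier⇒above  = λ β β≤0 → ≤-reflexive (cong (P ∘ x) (sym (toℕ-injective {i = β} {j = zero} (n≤0⇒n≡0 β≤0))))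
        ; above⇒earlier  = λ β P≤ → ≤-reflexive (cong toℕ (x-injective
                              (trans (m₀-unique (subst (_≤ P (x β)) P-x₀≡P-m₀ P≤)) (sym x₀≡m₀))))
        }

      ∣R-x₀∣≡1+k : ∣ R (x zero) ∣ ≡ suc k
      ∣R-x₀∣≡1+k rewrite x₀≡m₀ = trans (⊆-antisym⇒∣∣≡ R⊆Inc Inc⊆R) (∣Inc∣≡1+k m₀)
        where
        R⊆Inc : R m₀ ⊆ subset (Inc? m₀)
        R⊆Inc b∈ = ∈-subset⁺ (Inc? m₀) (proj₁ (proj₁ R-max) m₀ _ b∈)
        Inc⊆R : subset (Inc? m₀) ⊆ R m₀
        Inc⊆R b∈ = R-m₀ (λ m₀≺b → m₀≺b (∈-subset⁻ (Inc? m₀) b∈))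

    module Step {j j' : Fin (suc k)} (T : TopBlock j) (j'≡1+j : toℕ j' ≡ suc (toℕ j)) where
      open TopBlock T

      Px-j'<Px-j : P (x j') < P (x j)
      Px-j'<Px-j = ≰⇒> (λ P≤ → 1+n≰n (subst (_≤ toℕ j) j'≡1+j (above⇒earlier j' P≤)))

      next : ∃[ m ] P m < P (x j) × (∀ a → P a < P (x j) → P a ≤ P m)
      next = ∃-maximiser (λ a → P a <? P (x j)) P Px-j'<Px-j

      m : Fin N
      m = proj₁ next

      Pm<Px-j : P m < P (x j)
      Pm<Px-j = proj₁ (proj₂ next)

      below⇒≤Pm : ∀ a → P a < P (x j) → P a ≤ P m
      below⇒≤Pm = proj₂ (proj₂ next)

      Pm≤⇒ : ∀ {a} → P m ≤ P a → a ≡ m ⊎ P (x j) ≤ P a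
      Pm≤⇒ {a} Pm≤Pa with P a <? P (x j)
      ... | yes P< = inj₁ (P-injective (≤-antisym (below⇒≤Pm a P<) Pm≤Pa))
      ... | no  P≮ = inj₂ (≮⇒≥ P≮)

      R-x-j'⊆R-m : R (x j') ⊆ R m
      R-x-j'⊆R-m = R-mono (below⇒≤Pm (x j') Px-j'<Px-j)

      e-m≤k : e m ≤ k
      e-m≤k = e≤k (R-x-j'⊆R-m (s∈R j'))

      R-m⊆R-x-j' : R m ⊆ R (x j')
      R-m⊆R-x-j' with labelled (R-x-j'⊆R-m (s∈R j'))
      ... | β , x-β≡m = subst (λ a → R a ⊆ R (x j')) x-β≡m (nested (subst (_≤ toℕ β) (sym j'≡1+j) j<β))
        where
        j<β : toℕ j < toℕ β
        j<β = ≰⇒> (λ β≤j → <⇒≱ Pm<Px-j (subst (λ a → P (x j) ≤ P a) x-β≡m (earlier⇒above β β≤j)))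

      ∣R-x-j'∣≡∣R-m∣ : ∣ R (x j') ∣ ≡ ∣ R m ∣
      ∣R-x-j'∣≡∣R-m∣ = ⊆-antisym⇒∣∣≡ R-x-j'⊆R-m R-m⊆R-x-j'

      ∈R-m⁺ : ∀ {b} → b ∈ R (x j) → ¬ m ≺ b → b ∈ R m
      ∈R-m⁺ {b} b∈ m⊀b = P-clears⇒∈R below
        where
        below : ∀ a' → a' ≺ b → P a' < P m
        below a' a'≺b with P a' <? P m
        ... | yes P< = P<
        ... | no  P≮ with Pm≤⇒ (≮⇒≥ P≮)
        ...   | inj₁ refl = ⊥-elim (m⊀b a'≺b)
        ...   | inj₂ P≤   = ⊥-elim (<⇒≱ (∈R⇒P-clears b∈ a' a'≺b) P≤)

      ∈R-m⁻ : ∀ {b} → b ∈ R m → b ∈ R (x j) × ¬ m ≺ b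
      ∈R-m⁻ b∈ = R-mono (<⇒≤ Pm<Px-j) b∈ , λ m≺b → <-irrefl refl (∈R⇒P-clears b∈ m m≺b)

      below⇒∉block : ∀ {a} → P a < P (x j) → lo ≤ e a → e a ≤ hi → ⊥
      below⇒∉block P< lo≤ ≤hi = <⇒≱ P< (in-block⇒above _ lo≤ ≤hi)

      below⇒outside : ∀ {a} → P a < P (x j) → e a < lo ⊎ hi < e a
      below⇒outside {a} P< with lo ≤? e a | e a ≤? hi
      ... | no  lo≰ | _       = inj₁ (≰⇒> lo≰)
      ... | yes _   | no  ≰hi = inj₂ (≰⇒> ≰hi)
      ... | yes lo≤ | yes ≤hi = ⊥-elim (below⇒∉block P< lo≤ ≤hi)

      block⋖⇒above : ∀ {t a b} → lo ≤ t → t ≤ hi → t ⋖ w b → b ∈ R a → P (x j) < P a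
      block⋖⇒above {t} {a} lo≤t t≤hi t⋖ b∈ with ∃-at-e (≤-<-trans (≤-trans t≤hi hi≤k) k<N)
      ... | a' , refl = ≤-<-trans (in-block⇒above a' lo≤t t≤hi) (∈R⇒P-clears b∈ a' (⋖⇒≺ t⋖))

      module Extended {lo' hi'} (lo'≤lo : lo' ≤ lo) (hi≤hi' : hi ≤ hi') (lo'≤e-m : lo' ≤ e m) (e-m≤hi' : e m ≤ hi')
                      (hi'≤k : hi' ≤ k) (hi'≡lo'+j' : hi' ≡ lo' + toℕ j')
                      (cover : ∀ a → lo' ≤ e a → e a ≤ hi' → e a ≡ e m ⊎ (lo ≤ e a × e a ≤ hi)) where

        x-j'-outside : x j' ≢ m → e (x j') < lo' ⊎ hi' < e (x j')
        x-j'-outside x-j'≢m with lo' ≤? e (x j') | e (x j') ≤? hi'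
        ... | no  lo'≰ | _        = inj₁ (≰⇒> lo'≰)
        ... | yes _    | no  ≰hi' = inj₂ (≰⇒> ≰hi')
        ... | yes lo'≤ | yes ≤hi' with cover (x j') lo'≤ ≤hi'
        ...   | inj₁ e≡     = ⊥-elim (x-j'≢m (e-injective e≡))
        ...   | inj₂ (l , h) = ⊥-elim (below⇒∉block Px-j'<Px-j l h)

        x-j'≡m : x j' ≡ m
        x-j'≡m with x j' ≟ᶠ m
        ... | yes x-j'≡m = x-j'≡m
        ... | no  x-j'≢m with ∃-above-clear-of hi'≤k (ex≤k j') (x-j'-outside x-j'≢m)
        ...   | v , v<N , ⋖v , clear with ∃-at-w v<N
        ...     | b , refl = ⊥-elim (<-irrefl refl (∈R⇒P-clears (R-m⊆R-x-j' b∈R-m) (x j') (⋖⇒≺ ⋖v)))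
          where
          b∈R-m : b ∈ R m
          b∈R-m = ∈R-m⁺ (clear-of⇒∈R (clear-of-mono lo'≤lo hi≤hi' clear))
                        (clear⇒⊀ e-m≤k (clear-of⇒clear lo'≤e-m e-m≤hi' clear))

        P-x-j'≡P-m : P (x j') ≡ P m
        P-x-j'≡P-m = cong P x-j'≡m

        next-block : TopBlock j'
        next-block = record
          { lo = lo' ; hi = hi' ; hi≡lo+j = hi'≡lo'+j' ; hi≤k = hi'≤k
          ; above⇒in-block = above⇒in-block'
          ; in-block⇒above = in-block⇒above'
          ; earlier⇒above  = earlier⇒above'
          ; above⇒earlier  = above⇒earlier' }
          where
          above⇒in-block' : ∀ a → P (x j') ≤ P a → lo' ≤ e a × e a ≤ hi'
          above⇒in-block' a P≤ with Pm≤⇒ (subst (_≤ P a) P-x-j'≡P-m P≤)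
          ... | inj₁ refl = lo'≤e-m , e-m≤hi'
          ... | inj₂ P≤'  = ≤-trans lo'≤lo (proj₁ (above⇒in-block a P≤')) , ≤-trans (proj₂ (above⇒in-block a P≤')) hi≤hi'
          in-block⇒above' : ∀ a → lo' ≤ e a → e a ≤ hi' → P (x j') ≤ P a
          in-block⇒above' a lo'≤ ≤hi' with cover a lo'≤ ≤hi'
          ... | inj₁ e≡       = ≤-reflexive (trans P-x-j'≡P-m (cong P (sym (e-injective e≡))))
          ... | inj₂ (l , h) = <⇒≤ (<-≤-trans Px-j'<Px-j (in-block⇒above a l h))
          earlier⇒above' : ∀ β → toℕ β ≤ toℕ j' → P (x j') ≤ P (x β)
          earlier⇒above' β β≤j' with m≤n⇒m<n∨m≡n β≤j'
          ... | inj₂ β≡j' = ≤-reflexive (cong (P ∘ x) (sym (toℕ-injective {i = β} {j = j'} β≡j')))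
          ... | inj₁ β<j' = <⇒≤ (<-≤-trans Px-j'<Px-j (earlier⇒above β (≤-pred (subst (suc (toℕ β) ≤_) j'≡1+j β<j'))))
          above⇒earlier' : ∀ β → P (x j') ≤ P (x β) → toℕ β ≤ toℕ j'
          above⇒earlier' β P≤ with Pm≤⇒ (subst (_≤ P (x β)) P-x-j'≡P-m P≤)
          ... | inj₁ x-β≡m = ≤-reflexive (cong toℕ (x-injective (trans x-β≡m (sym x-j'≡m))))
          ... | inj₂ P≤'   = ≤-trans (above⇒earlier β P≤') (subst (toℕ j ≤_) (sym j'≡1+j) (n≤1+n _))

      ∣R∣-drop-one : ∀ p → p ∈ R (x j) → m ≺ p → (∀ {b} → b ∈ R (x j) → m ≺ b → b ≡ p) → ∣ R (x j) ∣ ≡ ∣ R m ∣ + 1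
      ∣R∣-drop-one p p∈ m≺p unique = trans (∣∣-partition (R (x j)) (R m) ⁅ p ⁆ cover (proj₁ ∘ ∈R-m⁻) p⊆ disjoint)
                                           (cong (∣ R m ∣ +_) (∣⁅x⁆∣≡1 p))
        where
        cover : ∀ {b} → b ∈ R (x j) → b ∈ R m ⊎ b ∈ ⁅ p ⁆
        cover {b} b∈ with m ≺? b
        ... | yes m≺b = inj₂ (subst (_∈ ⁅ p ⁆) (sym (unique b∈ m≺b)) (x∈⁅x⁆ p))
        ... | no  m⊀b = inj₁ (∈R-m⁺ b∈ m⊀b)
        p⊆ : ⁅ p ⁆ ⊆ R (x j)
        p⊆ b∈ rewrite x∈⁅y⁆⇒x≡y p b∈ = p∈
        disjoint : ∀ {b} → b ∈ R m → ¬ b ∈ ⁅ p ⁆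
        disjoint b∈ b∈p rewrite x∈⁅y⁆⇒x≡y p b∈p = proj₂ (∈R-m⁻ b∈) m≺p

      lo≤k : lo ≤ k
      lo≤k = ≤-trans lo≤hi hi≤k

      module LeftAdjacent (1+e-m≡lo : suc (e m) ≡ lo) where

        e-m≤lo : e m ≤ lo
        e-m≤lo = subst (e m ≤_) 1+e-m≡lo (n≤1+n _)

        hi≡e-m+j' : hi ≡ e m + toℕ j'
        hi≡e-m+j' = trans hi≡lo+j (trans (cong (_+ toℕ j) (sym 1+e-m≡lo)) (trans (sym (+-suc (e m) (toℕ j))) (cong (e m +_) (sym j'≡1+j))))

        cover : ∀ a → e m ≤ e a → e a ≤ hi → e a ≡ e m ⊎ (lo ≤ e a × e a ≤ hi)
        cover a e-m≤ ≤hi with m≤n⇒m<n∨m≡n e-m≤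
        ... | inj₁ e-m< = inj₂ (subst (_≤ e a) 1+e-m≡lo e-m< , ≤hi)
        ... | inj₂ e-m≡ = inj₁ (sym e-m≡)

        open Extended e-m≤lo ≤-refl ≤-refl (≤-trans e-m≤lo lo≤hi) hi≤k hi≡e-m+j' cover public

        ∣R-x-j∣≡∣R-m∣+1 : ∣ R (x j) ∣ ≡ ∣ R m ∣ + 1
        ∣R-x-j∣≡∣R-m∣+1 with ∃-left-edge lo≤k (subst (e m <_) 1+e-m≡lo ≤-refl) (subst (_< e m + n) 1+e-m≡lo (1+t<t+n (e m)))
        ... | v , v<N , v+lo≡N , e-m⋖v with ∃-at-w v<N
        ...   | p , refl = ∣R∣-drop-one p (clear-of⇒∈R (inj₂ (≤-reflexive (sym v+lo≡N)))) (⋖⇒≺ e-m⋖v) unique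
          where
          unique : ∀ {b} → b ∈ R (x j) → m ≺ b → b ≡ p
          unique {b} b∈ m≺b = w-injective (+-cancelʳ-≡ lo (w b) (w p)
            (trans (left-edge-unique 1+e-m≡lo (≺⇒⋖ e-m≤k m≺b) (λ lo⋖ → <-irrefl refl (block⋖⇒above ≤-refl lo≤hi lo⋖ b∈)))
                   (sym v+lo≡N)))

      module RightAdjacent (e-m≡1+hi : e m ≡ suc hi) where

        hi≤e-m : hi ≤ e m
        hi≤e-m = subst (hi ≤_) (sym e-m≡1+hi) (n≤1+n _)

        e-m≡lo+j' : e m ≡ lo + toℕ j'
        e-m≡lo+j' = trans e-m≡1+hi (trans (cong suc hi≡lo+j) (trans (sym (+-suc lo (toℕ j))) (cong (lo +_) (sym j'≡1+j))))

        cover : ∀ a → lo ≤ e a → e a ≤ e m → e a ≡ e m ⊎ (lo ≤ e a × e a ≤ hi)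
        cover a lo≤ ≤e-m with m≤n⇒m<n∨m≡n ≤e-m
        ... | inj₁ <e-m = inj₂ (lo≤ , ≤-pred (subst (e a <_) e-m≡1+hi <e-m))
        ... | inj₂ ≡e-m = inj₁ ≡e-m

        open Extended ≤-refl hi≤e-m (≤-trans lo≤hi hi≤e-m) ≤-refl e-m≤k e-m≡lo+j' cover public

        ∣R-x-j∣≡∣R-m∣+1 : ∣ R (x j) ∣ ≡ ∣ R m ∣ + 1
        ∣R-x-j∣≡∣R-m∣+1 with ∃-right-edge e-m≤k (subst (hi <_) (sym e-m≡1+hi) ≤-refl) (subst (_< hi + n) (sym e-m≡1+hi) (1+t<t+n hi))
        ... | v , v<N , v+hi≡k , e-m⋖v with ∃-at-w v<N
        ...   | p , refl = ∣R∣-drop-one p (clear-of⇒∈R (inj₁ (≤-reflexive v+hi≡k))) (⋖⇒≺ e-m⋖v) unique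
          where
          unique : ∀ {b} → b ∈ R (x j) → m ≺ b → b ≡ p
          unique {b} b∈ m≺b = w-injective (+-cancelʳ-≡ hi (w b) (w p)
            (trans (right-edge-unique e-m≡1+hi (≺⇒⋖ e-m≤k m≺b) (λ hi⋖ → <-irrefl refl (block⋖⇒above lo≤hi ≤-refl hi⋖ b∈)))
                   (sym v+hi≡k)))

      swap-contradiction : ∀ {y b₀} → P y < P (x j) → y ≢ m →
                           (∀ {b} → y ≺ b → ¬ m ≺ b → ∃[ t ] lo ≤ t × t ≤ hi × t ⋖ w b) →
                           m ≺ b₀ → ¬ y ≺ b₀ → (∀ {a} → a ≺ b₀ → P a < P (x j)) → ⊥
      swap-contradiction {y} Py<Px-j y≢m above-y-not-m m≺b₀ y⊀b₀ below-b₀ =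
        ¬promotable Py<Pm above-y m≺b₀ y⊀b₀ (λ a≺b₀ _ → below⇒≤Pm _ (below-b₀ a≺b₀))
        where
        Py<Pm : P y < P m
        Py<Pm = P-≤∧≢⇒< (below⇒≤Pm y Py<Px-j) y≢m
        above-y : ∀ {a b} → y ≺ b → b ∈ R a → a ≢ y → P m < P a
        above-y {a} {b} y≺b b∈ _ with m ≺? b
        ... | yes m≺b = ∈R⇒P-clears b∈ m m≺b
        ... | no  m⊀b with above-y-not-m y≺b m⊀b
        ...   | t , lo≤t , t≤hi , t⋖ = <-trans Pm<Px-j (block⋖⇒above lo≤t t≤hi t⋖ b∈)

      ¬left-gap : ∀ {ly} → suc ly ≡ lo → suc (e m) ≤ ly → suc ly < e m + n → ⊥
      ¬left-gap {ly} 1+ly≡lo e-m<ly 1+ly<e-m+n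
        with ∃-at-e (≤-<-trans (≤-trans (n≤1+n ly) (subst (_≤ k) (sym 1+ly≡lo) lo≤k)) k<N) | ∃-last-above e-m≤k
      ... | y , refl | v , v<N , e-m⋖v , beyond with ∃-at-w v<N
      ...   | b₀ , refl = swap-contradiction Py<Px-j y≢m above-y-not-m (⋖⇒≺ e-m⋖v) (clear⇒⊀ e-y≤k (inj₂ (beyond e-m<ly))) below-b₀
        where
        e-y≤k : e y ≤ k
        e-y≤k = ≤-trans (n≤1+n (e y)) (subst (_≤ k) (sym 1+ly≡lo) lo≤k)
        Py<Px-j : P y < P (x j)
        Py<Px-j = ≰⇒> λ P≤ → <⇒≱ (subst (e y <_) 1+ly≡lo ≤-refl) (proj₁ (above⇒in-block y P≤))
        y≢m : y ≢ m
        y≢m refl = <-irrefl refl e-m<ly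
        above-y-not-m : ∀ {b} → y ≺ b → ¬ m ≺ b → ∃[ t ] lo ≤ t × t ≤ hi × t ⋖ w b
        above-y-not-m y≺b m⊀b with left-swap-⋖ e-m<ly 1+ly<e-m+n (≺⇒⋖ e-y≤k y≺b)
        ... | inj₁ 1+ly⋖ = suc (e y) , ≤-reflexive (sym 1+ly≡lo) , subst (_≤ hi) (sym 1+ly≡lo) lo≤hi , 1+ly⋖
        ... | inj₂ e-m⋖  = ⊥-elim (m⊀b (⋖⇒≺ e-m⋖))
        below-b₀ : ∀ {a} → a ≺ b₀ → P a < P (x j)
        below-b₀ {a} a≺b₀ = ≰⇒> λ P≤ → clear⇒⊀ (≤-trans (proj₂ (above⇒in-block a P≤)) hi≤k)
          (inj₂ (beyond (<-trans e-m<ly (subst (_≤ e a) (sym 1+ly≡lo) (proj₁ (above⇒in-block a P≤)))))) a≺b₀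

      ¬right-gap : suc (suc hi) ≤ e m → e m < hi + n → ⊥
      ¬right-gap 2+hi≤e-m e-m<hi+n
        with ∃-at-e (≤-<-trans (≤-trans (n≤1+n _) (≤-trans 2+hi≤e-m e-m≤k)) k<N) | ∃-first-above e-m≤k
      ... | y , e-y≡1+hi | v , v<N , e-m⋖v , before with ∃-at-w v<N
      ...   | b₀ , refl = swap-contradiction Py<Px-j y≢m above-y-not-m (⋖⇒≺ e-m⋖v) y⊀b₀ below-b₀
        where
        e-y≤k : e y ≤ k
        e-y≤k = subst (_≤ k) (sym e-y≡1+hi) (≤-trans (n≤1+n _) (≤-trans 2+hi≤e-m e-m≤k))
        Py<Px-j : P y < P (x j)
        Py<Px-j = ≰⇒> λ P≤ → 1+n≰n (subst (_≤ hi) e-y≡1+hi (proj₂ (above⇒in-block y P≤)))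
        y≢m : y ≢ m
        y≢m refl = 1+n≰n (subst (suc (suc hi) ≤_) e-y≡1+hi 2+hi≤e-m)
        y⊀b₀ : ¬ y ≺ b₀
        y⊀b₀ = clear⇒⊀ e-y≤k (inj₁ (subst (λ t → t + w b₀ ≤ k) (sym e-y≡1+hi) (before 2+hi≤e-m)))
        above-y-not-m : ∀ {b} → y ≺ b → ¬ m ≺ b → ∃[ t ] lo ≤ t × t ≤ hi × t ⋖ w b
        above-y-not-m {b} y≺b m⊀b with right-swap-⋖ 2+hi≤e-m e-m<hi+n (subst (_⋖ w b) e-y≡1+hi (≺⇒⋖ e-y≤k y≺b))
        ... | inj₁ hi⋖  = hi , lo≤hi , ≤-refl , hi⋖
        ... | inj₂ e-m⋖ = ⊥-elim (m⊀b (⋖⇒≺ e-m⋖))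
        below-b₀ : ∀ {a} → a ≺ b₀ → P a < P (x j)
        below-b₀ {a} a≺b₀ = ≰⇒> λ P≤ → clear⇒⊀ (≤-trans (proj₂ (above⇒in-block a P≤)) hi≤k)
          (inj₁ (before (≤-<-trans (proj₂ (above⇒in-block a P≤)) (≤-trans (n≤1+n _) 2+hi≤e-m)))) a≺b₀

      data Position : Set where
        left-adjacent  : suc (e m) ≡ lo → Position
        right-adjacent : e m ≡ suc hi → Position
        apart          : Apart (e m) lo hi → Position

      position : Position
      position with below⇒outside Pm<Px-j
      ... | inj₁ e-m<lo with m≤n⇒m<n∨m≡n e-m<lo
      ...   | inj₂ 1+e-m≡lo = left-adjacent 1+e-m≡lo
      ...   | inj₁ 2+e-m≤lo with e m + n ≤? lo
      ...     | yes e-m+n≤lo = apart (inj₁ e-m+n≤lo)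
      ...     | no  e-m+n≰lo = ⊥-elim (¬left-gap 1+pred-lo≡lo
                                 (≤-pred (subst (suc (suc (e m)) ≤_) (sym 1+pred-lo≡lo) 2+e-m≤lo))
                                 (subst (_< e m + n) (sym 1+pred-lo≡lo) (≰⇒> e-m+n≰lo)))
        where
        1+pred-lo≡lo : suc (pred lo) ≡ lo
        1+pred-lo≡lo = suc-pred lo {{>-nonZero (≤-trans (s≤s z≤n) 2+e-m≤lo)}}
      position | inj₂ hi<e-m with m≤n⇒m<n∨m≡n hi<e-m
      ...   | inj₂ 1+hi≡e-m = right-adjacent (sym 1+hi≡e-m)
      ...   | inj₁ 2+hi≤e-m with hi + n ≤? e m
      ...     | yes hi+n≤e-m = apart (inj₂ hi+n≤e-m)
      ...     | no  hi+n≰e-m = ⊥-elim (¬right-gap 2+hi≤e-m (≰⇒> hi+n≰e-m))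

      module Distant (e-m-apart : Apart (e m) lo hi) where

        far-point : ∀ {a} → P a < P (x j) → a ≢ m → e a ≤ k → ∃[ b ] b ∈ R m × a ≺ b
        far-point {a} P< a≢m e-a≤k
          with ∃-above-clear-of-avoiding lo≤hi hi≤k e-a≤k (below⇒outside P<) (a≢m ∘ e-injective) e-m-apart
        ... | v , v<N , e-a⋖v , clear-of , clear-m with ∃-at-w v<N
        ...   | b , refl = b , ∈R-m⁺ (clear-of⇒∈R clear-of) (clear⇒⊀ e-m≤k clear-m) , ⋖⇒≺ e-a⋖v

        x-j'≡m : x j' ≡ m
        x-j'≡m with x j' ≟ᶠ m
        ... | yes x-j'≡m = x-j'≡m
        ... | no  x-j'≢m with far-point Px-j'<Px-j x-j'≢m (ex≤k j')
        ...   | b , b∈R-m , x-j'≺b = ⊥-elim (<-irrefl refl (∈R⇒P-clears (R-m⊆R-x-j' b∈R-m) (x j') x-j'≺b))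

        1+∣R-x-j∣≡∣R-x-j'∣+n : suc ∣ R (x j) ∣ ≡ ∣ R (x j') ∣ + n
        1+∣R-x-j∣≡∣R-x-j'∣+n = begin
          suc ∣ R (x j) ∣                           ≡⟨ cong suc (∣∣-partition (R (x j)) (R m) (subset (m ≺?_)) cover (proj₁ ∘ ∈R-m⁻) above-m⊆ disjoint) ⟩
          suc (∣ R m ∣ + ∣ subset (m ≺?_) ∣)        ≡⟨ +-suc _ _ ⟨
          ∣ R m ∣ + suc ∣ subset (m ≺?_) ∣          ≡⟨ cong₂ _+_ (sym ∣R-x-j'∣≡∣R-m∣) (1+∣≻∣≡n m) ⟩
          ∣ R (x j') ∣ + n                          ∎
          where
          open ≡-Reasoning
          cover : ∀ {b} → b ∈ R (x j) → b ∈ R m ⊎ b ∈ subset (m ≺?_)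
          cover {b} b∈ with m ≺? b
          ... | yes m≺b = inj₂ (∈-subset⁺ (m ≺?_) m≺b)
          ... | no  m⊀b = inj₁ (∈R-m⁺ b∈ m⊀b)
          above-m⊆ : subset (m ≺?_) ⊆ R (x j)
          above-m⊆ b∈ = clear-of⇒∈R (apart-⋖⇒clear-of e-m-apart (≺⇒⋖ e-m≤k (∈-subset⁻ (m ≺?_) b∈)))
          disjoint : ∀ {b} → b ∈ R m → ¬ b ∈ subset (m ≺?_)
          disjoint b∈ b∈' = proj₂ (∈R-m⁻ b∈) (∈-subset⁻ (m ≺?_) b∈')

        later-smaller : ∀ j″ → toℕ j' < toℕ j″ → ∣ R (x j″) ∣ < ∣ R (x j') ∣
        later-smaller j″ j'<j″ = lose (far-point Px-j″<Px-j x-j″≢m (ex≤k j″))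
          where
          Px-j″<Px-j : P (x j″) < P (x j)
          Px-j″<Px-j = ≰⇒> λ P≤ → <-irrefl refl (≤-trans (≤-trans (s≤s (above⇒earlier j″ P≤)) (≤-reflexive (sym j'≡1+j))) (<⇒≤ j'<j″))
          x-j″≢m : x j″ ≢ m
          x-j″≢m x-j″≡m = <-irrefl (cong toℕ (x-injective (trans x-j'≡m (sym x-j″≡m)))) j'<j″
          lose : (∃[ b ] b ∈ R m × x j″ ≺ b) → ∣ R (x j″) ∣ < ∣ R (x j') ∣
          lose (b , b∈R-m , x-j″≺b) = subst (∣ R (x j″) ∣ <_) (sym ∣R-x-j'∣≡∣R-m∣)
            (p⊂q⇒∣p∣<∣q∣ (R-mono (below⇒≤Pm (x j″) Px-j″<Px-j) , b , b∈R-m , λ b∈ → <-irrefl refl (∈R⇒P-clears b∈ (x j″) x-j″≺b)))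

        j+n≤k : toℕ j + n ≤ k
        j+n≤k = apart⇒j+n≤k e-m-apart hi≡lo+j hi≤k e-m≤k

    data StepOutcome (j j' : Fin (suc k)) : Set where
      adjacent : TopBlock j' → ∣ R (x j) ∣ ≡ ∣ R (x j') ∣ + 1 → StepOutcome j j'
      distant  : suc ∣ R (x j) ∣ ≡ ∣ R (x j') ∣ + n → toℕ j + n ≤ k →
                 (∀ j″ → toℕ j' < toℕ j″ → ∣ R (x j″) ∣ < ∣ R (x j') ∣) → StepOutcome j j'

    step : ∀ {j j'} → TopBlock j → toℕ j' ≡ suc (toℕ j) → StepOutcome j j'
    step T j'≡1+j with Step.position T j'≡1+j
    ... | Step.left-adjacent 1+e-m≡lo = adjacent next-block (trans ∣R-x-j∣≡∣R-m∣+1 (cong (_+ 1) (sym (Step.∣R-x-j'∣≡∣R-m∣ T j'≡1+j))))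
      where open Step.LeftAdjacent T j'≡1+j 1+e-m≡lo
    ... | Step.right-adjacent e-m≡1+hi = adjacent next-block (trans ∣R-x-j∣≡∣R-m∣+1 (cong (_+ 1) (sym (Step.∣R-x-j'∣≡∣R-m∣ T j'≡1+j))))
      where open Step.RightAdjacent T j'≡1+j e-m≡1+hi
    ... | Step.apart e-m-apart = distant 1+∣R-x-j∣≡∣R-x-j'∣+n j+n≤k later-smaller
      where open Step.Distant T j'≡1+j e-m-apart

    predecessor : ∀ {j : Fin (suc k)} → 0 < toℕ j → ∃[ j₋ ] toℕ j ≡ suc (toℕ j₋)
    predecessor {j} 0<j = fromℕ< p<1+k , trans (sym (suc-pred (toℕ j) {{>-nonZero 0<j}})) (cong suc (sym (toℕ-fromℕ< p<1+k)))
      where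
      p<1+k : pred (toℕ j) < suc k
      p<1+k = ≤-<-trans pred[n]≤n (toℕ<n j)

    module _ (i : Fin (suc k)) (i-breaks : ∣ R (x i) ∣ + suc (toℕ i) ≢ k + 2)
             (staircase : ∀ j → toℕ j < toℕ i → ∣ R (x j) ∣ + suc (toℕ j) ≡ k + 2) where

      top-block : ∀ α → α < toℕ i → ∀ {j} → toℕ j ≡ α → TopBlock j
      top-block zero    _     {j} j≡0 = subst TopBlock (sym (toℕ-injective {i = j} {j = zero} j≡0)) Top.top-block₀
      top-block (suc α) 1+α<i {j} j≡1+α with predecessor (subst (0 <_) (sym j≡1+α) (s≤s z≤n))
      ... | j₋ , j≡1+j₋ with step (top-block α (<-trans (n<1+n α) 1+α<i) (suc-injective (trans (sym j≡1+j₋) j≡1+α))) j≡1+j₋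
      ...   | adjacent T _      = T
      ...   | distant grows _ _ = ⊥-elim (distant-breaks-staircase grows
                                    (staircase j₋ (subst (_< toℕ i) (sym (suc-injective (trans (sym j≡1+j₋) j≡1+α))) (<-trans (n<1+n α) 1+α<i)))
                                    (subst (λ t → ∣ R (x j) ∣ + suc t ≡ k + 2) j≡1+j₋ (staircase j (subst (_< toℕ i) (sym j≡1+α) 1+α<i))))

      0<i : 0 < toℕ i
      0<i = ≰⇒> λ i≤0 → i-breaks (subst (λ j → ∣ R (x j) ∣ + suc (toℕ j) ≡ k + 2)
                                       (sym (toℕ-injective {i = i} {j = zero} (n≤0⇒n≡0 i≤0)))
                                       (trans (cong (_+ 1) Top.∣R-x₀∣≡1+k) (sym (+-suc k 1))))

      Conclusion : Set
      Conclusion = (2 ≤ suc (toℕ i) × suc (toℕ i) + n ≤ k + 2)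
                   × (∣ R (x i) ∣ + suc (toℕ i) + n ≡ k + 4)
                   × (∀ j → toℕ i < toℕ j → ∣ R (x j) ∣ + suc (toℕ i) + n ≤ k + 3)

      theorem : Conclusion
      theorem with predecessor 0<i
      ... | i₋ , i≡1+i₋ = conclude (step (top-block (toℕ i₋) i₋<i refl) i≡1+i₋)
        where
        i₋<i : toℕ i₋ < toℕ i
        i₋<i = subst (toℕ i₋ <_) (sym i≡1+i₋) ≤-refl
        i₋-size : ∣ R (x i₋) ∣ + suc (toℕ i₋) ≡ k + 2
        i₋-size = staircase i₋ i₋<i
        at-i : ∀ {F : ℕ → Set} → F (suc (toℕ i₋)) → F (toℕ i)
        at-i {F} = subst F (sym i≡1+i₋)
        conclude : StepOutcome i₋ i → Conclusion
        conclude (adjacent _ drop) = ⊥-elim (i-breaks (at-i {λ t → ∣ R (x i) ∣ + suc t ≡ k + 2} (adjacent-size drop i₋-size)))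
        conclude (distant grows i₋+n≤k later) =
          (s≤s 0<i , at-i {λ t → suc t + n ≤ k + 2} (≤-trans (s≤s (s≤s i₋+n≤k)) (≤-reflexive (+-comm 2 k)))) ,
          size , λ j i<j → smaller-size (later j i<j) size
          where
          size : ∣ R (x i) ∣ + suc (toℕ i) + n ≡ k + 4
          size = at-i {λ t → ∣ R (x i) ∣ + suc t + n ≡ k + 4} (distant-size grows i₋-size)

lemma3p2 : (n k : ℕ) → 3 ≤ n → (R : RSet n k) → MaxReversible n k R → ¬ Canonical n k R →
    (x : Fin (suc k) → Fin (n + k)) → ConsistentLabeling n k R x →
    (i : Fin (suc k)) →
    ∣ R (x i) ∣ + suc (toℕ i) ≢ k + 2 →
    (∀ j → toℕ j < toℕ i → ∣ R (x j) ∣ + suc (toℕ j) ≡ k + 2) →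
    ((2 ≤ suc (toℕ i) × suc (toℕ i) + n ≤ k + 2)
     × (∣ R (x i) ∣ + suc (toℕ i) + n ≡ k + 4)
     × (∀ j → toℕ i < toℕ j → ∣ R (x j) ∣ + suc (toℕ i) + n ≤ k + 3))
lemma3p2 _ k (s≤s (s≤s (s≤s {n = n'} z≤n))) R R-max _ x x-consistent i i-breaks staircase =
  MaximalReversible.Labelled.theorem n' k R R-max x x-consistent i i-breaks staircase
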